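{- Let $p$ be a prime, $a\in\mathbb{F}_p^{*}$, $N_{p,a}$ the number of $\mathbb{F}_p$-rational points (including the point at infinity) of $y^{2}=x^{3}+a^{3}$ over $\mathbb{F}_p$, and $b=p+1-N_{p,a}$. If $p\equiv 1\pmod{12}$, then $b\equiv 2\pmod{12}$ or $b\equiv -2\pmod{12}$. If $p\equiv 7\pmod{12}$, then $b\equiv 4\pmod{12}$ or $b\equiv -4\pmod{12}$.
   Context: The curve $y^2=x^3+a^3$ with $a\neq0$ is considered over the prime field $\mathbb{F}_p$. -}

module Defs where

open import Data.Nat using (ℕ; suc; _+_; _*_; _%_; NonZero)
open import Data.Nat.Properties using (_≟_)
open import Data.Fin using (Fin; toℕ)
open import Data.List using (List; length; filter; allFin; cartesianProduct)
open import Data.Product using (_×_; _,_)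
open import Data.Integer using (ℤ; +_; _-_)
open import Relation.Binary.PropositionalEquality using (_≡_)
open import Relation.Nullary using (Dec)

-- Elements of F_p are represented by Fin p (residues 0..p-1); arithmetic is
-- ℕ arithmetic followed by reduction mod p.

OnCurve : (p : ℕ) .{{_ : NonZero p}} → ℕ → Fin p × Fin p → Set
OnCurve p a (x , y) =
  (toℕ y * toℕ y) % p ≡ (toℕ x * toℕ x * toℕ x + a * a * a) % p

onCurve? : (p : ℕ) .{{_ : NonZero p}} (a : ℕ) (pt : Fin p × Fin p) → Dec (OnCurve p a pt)
onCurve? p a (x , y) = ((toℕ y * toℕ y) % p) ≟ ((toℕ x * toℕ x * toℕ x + a * a * a) % p)

affinePoints : (p : ℕ) .{{_ : NonZero p}} → ℕ → List (Fin p × Fin p)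
affinePoints p a = filter (onCurve? p a) (cartesianProduct (allFin p) (allFin p))

-- N_{p,a}: number of F_p-rational points including the point at infinity.
N : (p : ℕ) .{{_ : NonZero p}} → ℕ → ℕ
N p a = suc (length (affinePoints p a))

trace : (p : ℕ) .{{_ : NonZero p}} → ℕ → ℤ
trace p a = + (suc p) - + (N p a)

module Submission where

-- Write N = 1 + Σₓ #√(x³ + a³), where #√ c, the number of square roots of c in 𝔽ₚ, is 1 if c = 0,
-- 2 if c is a nonzero square and 0 otherwise. Both hypotheses give p ≡ 1 (mod 3), so 𝔽ₚ contains a
-- primitive cube root of unity ω: the order-3 map x ↦ 1/(1 − x), made to fix 0 and 1, has ≡ p
-- (mod 3) fixed points, hence a third one x, and −x is such an ω.
-- Modulo 3: x ↦ ωx preserves x³ and fixes only 0, so N − 1 ≡ #√(a³) ∈ {0, 2}.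
-- Modulo 4: x³ + a³ has the three roots −a, −aω, −aω², so N − 1 = 3 + 2h, where h counts the x
-- for which x³ + a³ is a nonzero square. In u = x + a the curve reads y² = g(u) = u(u² − 3au + 3a²),
-- and translation by the 2-torsion point (−a, 0) acts on x-coordinates as u ↦ 3a²/u. This
-- involution preserves squareness of g(u), and so does u ↦ −u on its fixed points u² = 3a², where
-- g(u)g(−u) = −27a⁶ = ((2ω + 1)·3a³)². Only u = 0 is left over, and it does not count, so h is even.
-- Hence N ≡ 0 or 4 (mod 12), and the claim follows from b = p + 1 − N.

open import Defs
open import Data.Nat using (ℕ; _%_; NonZero)
open import Data.Nat.Primality using (Prime)
open import Data.Integer using (ℤ; +_; -_; 1ℤ)
open import Data.Integer.DivMod using (_%ℕ_)
open import Data.Product using (_×_; _,_)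
open import Data.Sum using (_⊎_; inj₁; inj₂; [_,_]′)
open import Relation.Binary.PropositionalEquality using (_≡_; refl)
open import Relation.Nullary using (¬_)

module Counting where

  open import Level using (0ℓ)
  open import Data.Nat as ℕ using (zero; suc; _+_; _*_)
  import Data.Nat.Properties as ℕ
  open import Data.Bool using (if_then_else_)
  open import Data.Fin using (Fin; zero; suc)
  open import Data.Fin.Properties using (_≟_; _<?_; <-cmp; <-asym; <-trans; <-irrefl)
  open import Data.Fin.Permutation using (permutation)
  open import Data.List using (List; []; _∷_; length; filter; tabulate; map; _++_; cartesianProduct)
  import Data.List.Properties as List
  open import Data.List.Relation.Unary.All using (All; lookup)
  open import Data.List.Relation.Unary.Unique.Propositional using (Unique; []; _∷_)
  open import Data.List.Membership.Propositional using (_∈_)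
  open import Data.Product using (_,_; ∃; proj₁; proj₂)
  open import Data.Empty using (⊥-elim)
  open import Function using (_∘_)
  open import Relation.Binary.Definitions using (tri<; tri≈; tri>)
  open import Relation.Nullary using (Dec; does; yes; no)
  open import Relation.Nullary.Decidable using (_×-dec_)
  open import Relation.Unary using (Pred; Decidable)
  open import Relation.Binary.PropositionalEquality using (sym; trans; cong; cong₂; module ≡-Reasoning)
  open import Algebra.Properties.Semiring.Sum ℕ.+-*-semiring
    using (sum-cong-≗; sum-replicate-zero; ∑-distrib-+; ∑-permute; *-distribˡ-sum)
    renaming (sum to ∑) public

  𝟙 : ∀ {P : Set} → Dec P → ℕ
  𝟙 P? = if does P? then 1 else 0

  𝟙-yes : ∀ {P : Set} (P? : Dec P) → P → 𝟙 P? ≡ 1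
  𝟙-yes (yes _) _ = refl
  𝟙-yes (no ¬p) p = ⊥-elim (¬p p)

  𝟙-no : ∀ {P : Set} (P? : Dec P) → ¬ P → 𝟙 P? ≡ 0
  𝟙-no (yes p) ¬p = ⊥-elim (¬p p)
  𝟙-no (no _)  _  = refl

  𝟙-⇔ : ∀ {P Q : Set} (P? : Dec P) (Q? : Dec Q) → (P → Q) → (Q → P) → 𝟙 P? ≡ 𝟙 Q?
  𝟙-⇔ (yes _) (yes _) _   _   = refl
  𝟙-⇔ (yes p) (no ¬q) p⇒q _   = ⊥-elim (¬q (p⇒q p))
  𝟙-⇔ (no ¬p) (yes q) _   q⇒p = ⊥-elim (¬p (q⇒p q))
  𝟙-⇔ (no _)  (no _)  _   _   = refl

  ∑-const-1 : ∀ n → ∑ {n} (λ _ → 1) ≡ n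
  ∑-const-1 zero    = refl
  ∑-const-1 (suc n) = cong suc (∑-const-1 n)

  ∑-select : ∀ {n} (f : Fin n → ℕ) (c : Fin n) → ∑ (λ i → f i * 𝟙 (i ≟ c)) ≡ f c
  ∑-select {suc n} f zero = begin
    f zero * 1 + ∑ (λ i → f (suc i) * 0) ≡⟨ cong₂ _+_ (ℕ.*-identityʳ (f zero)) ∑-*0 ⟩
    f zero + 0                           ≡⟨ ℕ.+-identityʳ (f zero) ⟩
    f zero                               ∎
    where
    open ≡-Reasoning
    ∑-*0 : ∑ (λ i → f (suc i) * 0) ≡ 0
    ∑-*0 = trans (sum-cong-≗ (ℕ.*-zeroʳ ∘ f ∘ suc)) (sum-replicate-zero n)
  ∑-select {suc n} f (suc c) = cong₂ _+_ (ℕ.*-zeroʳ (f zero)) (∑-select (f ∘ suc) c)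

  ∑-reindex : ∀ {n} (σ σ⁻¹ : Fin n → Fin n) → (∀ x → σ (σ⁻¹ x) ≡ x) → (∀ x → σ⁻¹ (σ x) ≡ x) →
              (f : Fin n → ℕ) → ∑ (f ∘ σ) ≡ ∑ f
  ∑-reindex σ σ⁻¹ inverseˡ inverseʳ f = sym (∑-permute f (permutation σ σ⁻¹ inverseˡ inverseʳ))

  module _ {n : ℕ} where
    open import Data.List.Membership.DecPropositional (_≟_ {n}) using (_∈?_)

    ∑-𝟙-∈ : (rs : List (Fin n)) → Unique rs → ∑ (λ x → 𝟙 (x ∈? rs)) ≡ length rs
    ∑-𝟙-∈ []       []                 = sum-replicate-zero n
    ∑-𝟙-∈ (r ∷ rs) (r∉rs ∷ rs-unique) = begin
      ∑ (λ x → 𝟙 (x ∈? r ∷ rs))                    ≡⟨ sum-cong-≗ split ⟩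
      ∑ (λ x → 𝟙 (x ≟ r) + 𝟙 (x ∈? rs))             ≡⟨ ∑-distrib-+ (λ x → 𝟙 (x ≟ r)) _ ⟩
      ∑ (λ x → 𝟙 (x ≟ r)) + ∑ (λ x → 𝟙 (x ∈? rs))   ≡⟨ cong₂ _+_ ∑-𝟙-≟ (∑-𝟙-∈ rs rs-unique) ⟩
      suc (length rs)                               ∎
      where
      open ≡-Reasoning
      split : ∀ x → 𝟙 (x ∈? r ∷ rs) ≡ 𝟙 (x ≟ r) + 𝟙 (x ∈? rs)
      split x with x ≟ r | x ∈? rs
      ... | yes refl | yes x∈rs = ⊥-elim (lookup r∉rs x∈rs refl)
      ... | yes _    | no _     = refl
      ... | no _     | yes _    = refl
      ... | no _     | no _     = refl
      ∑-𝟙-≟ : ∑ (λ x → 𝟙 (x ≟ r)) ≡ 1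
      ∑-𝟙-≟ = trans (sum-cong-≗ (λ x → sym (ℕ.*-identityˡ (𝟙 (x ≟ r))))) (∑-select (λ _ → 1) r)

    ∑-𝟙≡length : ∀ {Q : Pred (Fin n) 0ℓ} (Q? : Decidable Q) (rs : List (Fin n)) → Unique rs →
                 (∀ x → Q x → x ∈ rs) → All Q rs → ∑ (λ x → 𝟙 (Q? x)) ≡ length rs
    ∑-𝟙≡length Q? rs rs-unique complete sound =
      trans (sum-cong-≗ (λ x → 𝟙-⇔ (Q? x) (x ∈? rs) (complete x) (lookup sound))) (∑-𝟙-∈ rs rs-unique)

  ∑fix : ∀ {n} → (Fin n → Fin n) → (Fin n → ℕ) → ℕ
  ∑fix σ f = ∑ (λ x → f x * 𝟙 (σ x ≟ x))

  𝟙-trichotomy : ∀ {n} (i j : Fin n) → 𝟙 (j ≟ i) + (𝟙 (i <? j) + 𝟙 (j <? i)) ≡ 1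
  𝟙-trichotomy i j with <-cmp i j
  ... | tri< i<j i≢j j≮i = cong₂ _+_ (𝟙-no (j ≟ i) (i≢j ∘ sym)) (cong₂ _+_ (𝟙-yes (i <? j) i<j) (𝟙-no (j <? i) j≮i))
  ... | tri≈ i≮j i≡j j≮i = cong₂ _+_ (𝟙-yes (j ≟ i) (sym i≡j)) (cong₂ _+_ (𝟙-no (i <? j) i≮j) (𝟙-no (j <? i) j≮i))
  ... | tri> i≮j i≢j j<i = cong₂ _+_ (𝟙-no (j ≟ i) (i≢j ∘ sym)) (cong₂ _+_ (𝟙-no (i <? j) i≮j) (𝟙-yes (j <? i) j<i))

  𝟙-minimum₃ : ∀ {n} {i j k : Fin n} → ¬ i ≡ j → ¬ j ≡ k → ¬ k ≡ i →
               𝟙 (i <? j ×-dec i <? k) + (𝟙 (j <? k ×-dec j <? i) + 𝟙 (k <? i ×-dec k <? j)) ≡ 1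
  𝟙-minimum₃ {i = i} {j} {k} i≢j j≢k k≢i with <-cmp i j | <-cmp j k | <-cmp k i
  ... | tri≈ _ i≡j _ | _ | _ = ⊥-elim (i≢j i≡j)
  ... | _ | tri≈ _ j≡k _ | _ = ⊥-elim (j≢k j≡k)
  ... | _ | _ | tri≈ _ k≡i _ = ⊥-elim (k≢i k≡i)
  ... | tri< i<j _ _ | tri< j<k _ _ | tri< k<i _ _ = ⊥-elim (<-asym (<-trans i<j j<k) k<i)
  ... | tri> _ _ j<i | tri> _ _ k<j | tri> _ _ i<k = ⊥-elim (<-asym (<-trans k<j j<i) i<k)
  ... | tri< i<j _ _ | tri< j<k _ _ | tri> _ _ i<k =
    cong₂ _+_ (𝟙-yes (i <? j ×-dec i <? k) (i<j , i<k))
              (cong₂ _+_ (𝟙-no (j <? k ×-dec j <? i) (<-asym i<j ∘ proj₂)) (𝟙-no (k <? i ×-dec k <? j) (<-asym i<k ∘ proj₁)))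
  ... | tri< i<j _ _ | tri> _ _ k<j | tri< k<i _ _ =
    cong₂ _+_ (𝟙-no (i <? j ×-dec i <? k) (<-asym k<i ∘ proj₂))
              (cong₂ _+_ (𝟙-no (j <? k ×-dec j <? i) (<-asym k<j ∘ proj₁)) (𝟙-yes (k <? i ×-dec k <? j) (k<i , k<j)))
  ... | tri< i<j _ _ | tri> _ _ k<j | tri> _ _ i<k =
    cong₂ _+_ (𝟙-yes (i <? j ×-dec i <? k) (i<j , i<k))
              (cong₂ _+_ (𝟙-no (j <? k ×-dec j <? i) (<-asym k<j ∘ proj₁)) (𝟙-no (k <? i ×-dec k <? j) (<-asym i<k ∘ proj₁)))
  ... | tri> _ _ j<i | tri< j<k _ _ | tri< k<i _ _ =
    cong₂ _+_ (𝟙-no (i <? j ×-dec i <? k) (<-asym j<i ∘ proj₁))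
              (cong₂ _+_ (𝟙-yes (j <? k ×-dec j <? i) (j<k , j<i)) (𝟙-no (k <? i ×-dec k <? j) (<-asym j<k ∘ proj₂)))
  ... | tri> _ _ j<i | tri< j<k _ _ | tri> _ _ i<k =
    cong₂ _+_ (𝟙-no (i <? j ×-dec i <? k) (<-asym j<i ∘ proj₁))
              (cong₂ _+_ (𝟙-yes (j <? k ×-dec j <? i) (j<k , j<i)) (𝟙-no (k <? i ×-dec k <? j) (<-asym i<k ∘ proj₁)))
  ... | tri> _ _ j<i | tri> _ _ k<j | tri< k<i _ _ =
    cong₂ _+_ (𝟙-no (i <? j ×-dec i <? k) (<-asym j<i ∘ proj₁))
              (cong₂ _+_ (𝟙-no (j <? k ×-dec j <? i) (<-asym k<j ∘ proj₁)) (𝟙-yes (k <? i ×-dec k <? j) (k<i , k<j)))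

  split-by-weights : ∀ m a b → a + b ≡ 1 → m ≡ m * a + m * b
  split-by-weights m a b a+b≡1 = begin
    m             ≡⟨ ℕ.*-identityʳ m ⟨
    m * 1         ≡⟨ cong (m *_) a+b≡1 ⟨
    m * (a + b)   ≡⟨ ℕ.*-distribˡ-+ m a b ⟩
    m * a + m * b ∎
    where open ≡-Reasoning

  -- Each orbit of size q > 1 contributes q · f(x₀) through its least element x₀ only.
  module _ {n : ℕ} (σ : Fin n → Fin n) (f : Fin n → ℕ) (f∘σ≡f : ∀ x → f (σ x) ≡ f x) where

    ∑≡∑fix+2* : (∀ x → σ (σ x) ≡ x) → ∃ λ k → ∑ f ≡ ∑fix σ f + 2 * k
    ∑≡∑fix+2* σ²≡id = ∑ g , (begin
      ∑ f                                              ≡⟨ sum-cong-≗ pointwise ⟩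
      ∑ (λ x → f x * 𝟙 (σ x ≟ x) + (g x + g (σ x)))    ≡⟨ ∑-distrib-+ (λ x → f x * 𝟙 (σ x ≟ x)) _ ⟩
      ∑fix σ f + ∑ (λ x → g x + g (σ x))               ≡⟨ cong (λ t → ∑fix σ f + t) (∑-distrib-+ g (g ∘ σ)) ⟩
      ∑fix σ f + (∑ g + ∑ (g ∘ σ))                     ≡⟨ cong (λ t → ∑fix σ f + (∑ g + t)) ∑g∘σ≡∑g ⟩
      ∑fix σ f + 2 * ∑ g                               ∎)
      where
      open ≡-Reasoning
      least : Fin n → ℕ
      least x = 𝟙 (x <? σ x)
      g : Fin n → ℕ
      g x = f x * least x
      ∑g∘σ≡∑g : ∑ (g ∘ σ) ≡ ∑ g + 0
      ∑g∘σ≡∑g = trans (∑-reindex σ σ σ²≡id σ²≡id g) (sym (ℕ.+-identityʳ (∑ g)))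
      pointwise : ∀ x → f x ≡ f x * 𝟙 (σ x ≟ x) + (g x + g (σ x))
      pointwise x = begin
        f x                                                ≡⟨ split-by-weights (f x) _ _ (𝟙-trichotomy x (σ x)) ⟩
        f x * 𝟙 (σ x ≟ x) + f x * (least x + 𝟙 (σ x <? x))  ≡⟨ cong (λ t → f x * 𝟙 (σ x ≟ x) + t) (ℕ.*-distribˡ-+ (f x) _ _) ⟩
        f x * 𝟙 (σ x ≟ x) + (g x + f x * 𝟙 (σ x <? x))      ≡⟨ cong (λ t → f x * 𝟙 (σ x ≟ x) + (g x + t)) g∘σ ⟩
        f x * 𝟙 (σ x ≟ x) + (g x + g (σ x))                  ∎
        where
        g∘σ : f x * 𝟙 (σ x <? x) ≡ g (σ x)
        g∘σ = cong₂ (λ u v → u * 𝟙 (σ x <? v)) (sym (f∘σ≡f x)) (sym (σ²≡id x))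

    ∑≡∑fix+3* : (∀ x → σ (σ (σ x)) ≡ x) → ∃ λ k → ∑ f ≡ ∑fix σ f + 3 * k
    ∑≡∑fix+3* σ³≡id = ∑ g , (begin
      ∑ f                                                            ≡⟨ sum-cong-≗ pointwise ⟩
      ∑ (λ x → f x * 𝟙 (σ x ≟ x) + (g x + (g (σ x) + g (σ (σ x)))))  ≡⟨ ∑-distrib-+ (λ x → f x * 𝟙 (σ x ≟ x)) _ ⟩
      ∑fix σ f + ∑ (λ x → g x + (g (σ x) + g (σ (σ x))))             ≡⟨ cong (λ t → ∑fix σ f + t) (∑-distrib-+ g _) ⟩
      ∑fix σ f + (∑ g + ∑ (λ x → g (σ x) + g (σ (σ x))))             ≡⟨ cong (λ t → ∑fix σ f + (∑ g + t)) ∑g∘σ+g∘σ²≡2∑g ⟩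
      ∑fix σ f + 3 * ∑ g                                             ∎)
      where
      open ≡-Reasoning
      least : Fin n → ℕ
      least y = 𝟙 (y <? σ y ×-dec y <? σ (σ y))
      g : Fin n → ℕ
      g y = f y * least y
      ∑g∘σ+g∘σ²≡2∑g : ∑ (λ x → g (σ x) + g (σ (σ x))) ≡ ∑ g + (∑ g + 0)
      ∑g∘σ+g∘σ²≡2∑g = begin
        ∑ (λ x → g (σ x) + g (σ (σ x))) ≡⟨ ∑-distrib-+ (g ∘ σ) (g ∘ σ ∘ σ) ⟩
        ∑ (g ∘ σ) + ∑ (g ∘ σ ∘ σ)       ≡⟨ cong₂ _+_ (∑-reindex σ (σ ∘ σ) σ³≡id σ³≡id g)
                                                     (∑-reindex (σ ∘ σ) σ σ³≡id σ³≡id g) ⟩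
        ∑ g + ∑ g                       ≡⟨ cong (λ t → ∑ g + t) (ℕ.+-identityʳ (∑ g)) ⟨
        ∑ g + (∑ g + 0)                 ∎
      least-fixed : ∀ y → σ y ≡ y → least y ≡ 0
      least-fixed y σy≡y = 𝟙-no (y <? σ y ×-dec y <? σ (σ y)) (<-irrefl (sym σy≡y) ∘ proj₁)
      weights : ∀ x → 𝟙 (σ x ≟ x) + (least x + (least (σ x) + least (σ (σ x)))) ≡ 1
      weights x with σ x ≟ x
      ... | yes σx≡x = cong suc (cong₂ _+_ (least-fixed x σx≡x)
                         (cong₂ _+_ (least-fixed (σ x) (cong σ σx≡x)) (least-fixed (σ (σ x)) (cong σ (cong σ σx≡x)))))
      ... | no σx≢x  = trans (cong₂ (λ u v → least x + (𝟙 (σ x <? σ (σ x) ×-dec σ x <? u) + v)) (σ³≡id x) least-σσx)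
                             (𝟙-minimum₃ (σx≢x ∘ sym) σx≢σσx σσx≢x)
        where
        least-σσx : least (σ (σ x)) ≡ 𝟙 (σ (σ x) <? x ×-dec σ (σ x) <? σ x)
        least-σσx = cong₂ (λ u v → 𝟙 (σ (σ x) <? u ×-dec σ (σ x) <? v)) (σ³≡id x) (cong σ (σ³≡id x))
        σσx≢x : ¬ σ (σ x) ≡ x
        σσx≢x e = σx≢x (trans (sym (cong σ e)) (σ³≡id x))
        σx≢σσx : ¬ σ x ≡ σ (σ x)
        σx≢σσx e = σσx≢x (trans (cong σ e) (σ³≡id x))
      pointwise : ∀ x → f x ≡ f x * 𝟙 (σ x ≟ x) + (g x + (g (σ x) + g (σ (σ x))))
      pointwise x = begin
        f x
          ≡⟨ split-by-weights (f x) _ _ (weights x) ⟩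
        f x * 𝟙 (σ x ≟ x) + f x * (least x + (least (σ x) + least (σ (σ x))))
          ≡⟨ cong (λ t → f x * 𝟙 (σ x ≟ x) + t)
               (trans (ℕ.*-distribˡ-+ (f x) _ _) (cong (λ t → g x + t) (ℕ.*-distribˡ-+ (f x) _ _))) ⟩
        f x * 𝟙 (σ x ≟ x) + (g x + (f x * least (σ x) + f x * least (σ (σ x))))
          ≡⟨ cong (λ t → f x * 𝟙 (σ x ≟ x) + (g x + t))
               (cong₂ _+_ (cong (_* least (σ x)) (sym (f∘σ≡f x)))
                          (cong (_* least (σ (σ x))) (sym (trans (f∘σ≡f (σ x)) (f∘σ≡f x))))) ⟩
        f x * 𝟙 (σ x ≟ x) + (g x + (g (σ x) + g (σ (σ x))))
          ∎

  module _ {A : Set} {Q : Pred A 0ℓ} (Q? : Decidable Q) where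

    length-filter-tabulate : ∀ {n} (f : Fin n → A) → length (filter Q? (tabulate f)) ≡ ∑ (λ i → 𝟙 (Q? (f i)))
    length-filter-tabulate {zero}  f = refl
    length-filter-tabulate {suc n} f with Q? (f zero)
    ... | yes _ = cong suc (length-filter-tabulate (f ∘ suc))
    ... | no _  = length-filter-tabulate (f ∘ suc)

    length-filter-map : ∀ {B : Set} (h : B → A) (xs : List B) →
                        length (filter Q? (map h xs)) ≡ length (filter (Q? ∘ h) xs)
    length-filter-map h []       = refl
    length-filter-map h (x ∷ xs) with Q? (h x)
    ... | yes _ = cong suc (length-filter-map h xs)
    ... | no _  = length-filter-map h xs

    length-filter-++ : ∀ (xs ys : List A) → length (filter Q? (xs ++ ys)) ≡ length (filter Q? xs) + length (filter Q? ys)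
    length-filter-++ xs ys = trans (cong length (List.filter-++ Q? xs ys)) (List.length-++ (filter Q? xs))

  module _ {B C : Set} {Q : Pred (B × C) 0ℓ} (Q? : Decidable Q) where

    length-filter-cartesianProduct : ∀ {m} (f : Fin m → B) (ys : List C) →
      length (filter Q? (cartesianProduct (tabulate f) ys)) ≡ ∑ (λ i → length (filter (λ y → Q? (f i , y)) ys))
    length-filter-cartesianProduct {zero}  f ys = refl
    length-filter-cartesianProduct {suc m} f ys =
      trans (length-filter-++ Q? (map (f zero ,_) ys) _)
            (cong₂ _+_ (length-filter-map Q? (f zero ,_) ys) (length-filter-cartesianProduct (f ∘ suc) ys))

module Congruence (m : ℕ) where

  open import Level using (0ℓ)
  import Data.Nat as ℕ
  import Data.Nat.Properties as ℕ
  open import Data.Nat.DivMod using (m<n⇒m%n≡m)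
  open import Data.Nat.Divisibility using (n∣m⇒m%n≡0)
  open import Data.Integer using (_+_; _*_; _-_; ∣_∣; 0ℤ; 1ℤ)
  import Data.Integer.Properties as ℤ
  open import Data.Integer.DivMod using (_/ℕ_; n%ℕd<d; a≡a%ℕn+[a/ℕn]*n)
  open import Data.Integer.Divisibility.Signed using (_∣_; divides; _∣?_; ∣⇒∣ᵤ; ∣n⇒∣m*n; ∣m∣n⇒∣m+n)
  open import Data.Integer.Tactic.RingSolver using (solve-∀)
  open import Data.Fin using (Fin; toℕ; fromℕ<)
  open import Data.Fin.Properties using (toℕ<n; toℕ-injective; toℕ-fromℕ<)
  open import Function using (_∘_)
  open import Relation.Binary.Bundles using (Setoid)
  import Relation.Binary.Reasoning.Setoid
  open import Relation.Binary.PropositionalEquality using (sym; trans; cong; subst)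
  open import Relation.Nullary using (Dec)
  open import Relation.Nullary.Decidable using (map′)

  infix 4 _≈_ _≉_ _≈?_

  -- ℤ/mℤ is modelled by ℤ up to congruence modulo m, with canonical representatives in Fin m.
  -- A record rather than a synonym for + m ∣ a - b, so that a and b can be inferred from a proof.
  record _≈_ (a b : ℤ) : Set where
    constructor mk
    field divides-difference : + m ∣ a - b

  _≉_ : ℤ → ℤ → Set
  a ≉ b = ¬ a ≈ b

  -- Opaque, so that `with` can abstract over its occurrences in goals.
  opaque
    _≈?_ : ∀ a b → Dec (a ≈ b)
    a ≈? b = map′ mk _≈_.divides-difference (+ m ∣? a - b)

  -- A congruence a ≈ b is proved by writing a − b as an explicit combination of differences that
  -- are already known to vanish; the ring solver checks the identity.
  ≈-lincomb₁ : ∀ {a b a₁ b₁} → a₁ ≈ b₁ → ∀ c₁ → a - b ≡ c₁ * (a₁ - b₁) → a ≈ b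
  ≈-lincomb₁ (mk h₁) c₁ eq = mk (subst (+ m ∣_) (sym eq) (∣n⇒∣m*n c₁ h₁))

  ≈-lincomb₂ : ∀ {a b a₁ b₁ a₂ b₂} → a₁ ≈ b₁ → a₂ ≈ b₂ →
               ∀ c₁ c₂ → a - b ≡ c₁ * (a₁ - b₁) + c₂ * (a₂ - b₂) → a ≈ b
  ≈-lincomb₂ (mk h₁) (mk h₂) c₁ c₂ eq =
    mk (subst (+ m ∣_) (sym eq) (∣m∣n⇒∣m+n (∣n⇒∣m*n c₁ h₁) (∣n⇒∣m*n c₂ h₂)))

  ≈-lincomb₃ : ∀ {a b a₁ b₁ a₂ b₂ a₃ b₃} → a₁ ≈ b₁ → a₂ ≈ b₂ → a₃ ≈ b₃ →
               ∀ c₁ c₂ c₃ → a - b ≡ c₁ * (a₁ - b₁) + c₂ * (a₂ - b₂) + c₃ * (a₃ - b₃) → a ≈ b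
  ≈-lincomb₃ (mk h₁) (mk h₂) (mk h₃) c₁ c₂ c₃ eq =
    mk (subst (+ m ∣_) (sym eq) (∣m∣n⇒∣m+n (∣m∣n⇒∣m+n (∣n⇒∣m*n c₁ h₁) (∣n⇒∣m*n c₂ h₂)) (∣n⇒∣m*n c₃ h₃)))

  modulus≈0 : + m ≈ 0ℤ
  modulus≈0 = mk (divides 1ℤ (lemma (+ m)))
    where lemma : ∀ M → M - 0ℤ ≡ 1ℤ * M
          lemma = solve-∀

  +*modulus≈ : ∀ a k → a + k * + m ≈ a
  +*modulus≈ a k = ≈-lincomb₁ modulus≈0 k (lemma a k (+ m))
    where lemma : ∀ a k M → a + k * M - a ≡ k * (M - 0ℤ)
          lemma = solve-∀

  ≈0⇒∣ : ∀ {a} → a ≈ 0ℤ → + m ∣ a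
  ≈0⇒∣ {a} (mk m∣a-0) = subst (+ m ∣_) (ℤ.+-identityʳ a) m∣a-0

  ∣⇒≈0 : ∀ {a} → + m ∣ a → a ≈ 0ℤ
  ∣⇒≈0 {a} m∣a = mk (subst (+ m ∣_) (sym (ℤ.+-identityʳ a)) m∣a)

  ≈-reflexive : ∀ {a b} → a ≡ b → a ≈ b
  ≈-reflexive {a} refl = mk (divides 0ℤ (ℤ.+-inverseʳ a))

  ≈-refl : ∀ {a} → a ≈ a
  ≈-refl = ≈-reflexive refl

  ≈-sym : ∀ {a b} → a ≈ b → b ≈ a
  ≈-sym {a} {b} a≈b = ≈-lincomb₁ a≈b (- 1ℤ) (lemma a b)
    where lemma : ∀ a b → b - a ≡ - 1ℤ * (a - b)
          lemma = solve-∀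

  ≈-trans : ∀ {a b c} → a ≈ b → b ≈ c → a ≈ c
  ≈-trans {a} {b} {c} a≈b b≈c = ≈-lincomb₂ a≈b b≈c 1ℤ 1ℤ (lemma a b c)
    where lemma : ∀ a b c → a - c ≡ 1ℤ * (a - b) + 1ℤ * (b - c)
          lemma = solve-∀

  ≈-setoid : Setoid 0ℓ 0ℓ
  ≈-setoid = record
    { Carrier       = ℤ
    ; _≈_           = _≈_
    ; isEquivalence = record { refl = ≈-refl ; sym = ≈-sym ; trans = ≈-trans }
    }

  module ≈-Reasoning = Relation.Binary.Reasoning.Setoid ≈-setoid

  +-cong : ∀ {a b c d} → a ≈ b → c ≈ d → a + c ≈ b + d
  +-cong {a} {b} {c} {d} a≈b c≈d = ≈-lincomb₂ a≈b c≈d 1ℤ 1ℤ (lemma a b c d)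
    where lemma : ∀ a b c d → a + c - (b + d) ≡ 1ℤ * (a - b) + 1ℤ * (c - d)
          lemma = solve-∀

  *-cong : ∀ {a b c d} → a ≈ b → c ≈ d → a * c ≈ b * d
  *-cong {a} {b} {c} {d} a≈b c≈d = ≈-lincomb₂ a≈b c≈d c b (lemma a b c d)
    where lemma : ∀ a b c d → a * c - b * d ≡ c * (a - b) + b * (c - d)
          lemma = solve-∀

  -‿cong : ∀ {a b} → a ≈ b → - a ≈ - b
  -‿cong {a} {b} a≈b = ≈-lincomb₁ a≈b (- 1ℤ) (lemma a b)
    where lemma : ∀ a b → - a - - b ≡ - 1ℤ * (a - b)
          lemma = solve-∀

  module _ .{{_ : NonZero m}} where

    ≈-%ℕ : ∀ a → a ≈ + (a %ℕ m)
    ≈-%ℕ a = subst (_≈ + (a %ℕ m)) (sym (a≡a%ℕn+[a/ℕn]*n a m))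
                   (≈-lincomb₁ modulus≈0 (a /ℕ m) (lemma (+ (a %ℕ m)) (a /ℕ m) (+ m)))
      where lemma : ∀ r q M → r + q * M - r ≡ q * (M - 0ℤ)
            lemma = solve-∀

    residue-unique : ∀ {r s} → r ℕ.< m → s ℕ.< m → + r ≈ + s → r ≡ s
    residue-unique {r} {s} r<m s<m r≈s = ℤ.+-injective (ℤ.i-j≡0⇒i≡j (+ r) (+ s) (ℤ.∣i∣≡0⇒i≡0 ∣r-s∣≡0))
      where
      ∣r-s∣<m : ∣ + r - + s ∣ ℕ.< m
      ∣r-s∣<m = ℕ.≤-<-trans (subst (ℕ._≤ r ℕ.⊔ s) (cong ∣_∣ (sym (ℤ.m-n≡m⊖n r s))) (ℤ.∣m⊝n∣≤m⊔n r s))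
                            (ℕ.⊔-lub r<m s<m)
      ∣r-s∣≡0 : ∣ + r - + s ∣ ≡ 0
      ∣r-s∣≡0 = trans (sym (m<n⇒m%n≡m ∣r-s∣<m)) (n∣m⇒m%n≡0 _ m (∣⇒∣ᵤ (_≈_.divides-difference r≈s)))

    ≈⇒%ℕ-≡ : ∀ {a b} → a ≈ b → a %ℕ m ≡ b %ℕ m
    ≈⇒%ℕ-≡ {a} {b} a≈b = residue-unique (n%ℕd<d a m) (n%ℕd<d b m)
      (≈-trans (≈-sym (≈-%ℕ a)) (≈-trans a≈b (≈-%ℕ b)))

    %-≡⇒≈ : ∀ i j → i ℕ.% m ≡ j ℕ.% m → + i ≈ + j
    %-≡⇒≈ i j i%m≡j%m = ≈-trans (≈-%ℕ (+ i)) (≈-trans (≈-reflexive (cong +_ i%m≡j%m)) (≈-sym (≈-%ℕ (+ j))))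

    small≉0 : ∀ {k} → 0 ℕ.< k → k ℕ.< m → + k ≉ 0ℤ
    small≉0 0<k k<m k≈0 = ℕ.<⇒≢ 0<k (sym (residue-unique k<m (ℕ.≤-<-trans ℕ.z≤n k<m) k≈0))

    ι : Fin m → ℤ
    ι x = + toℕ x

    ι-injective : ∀ {x y} → ι x ≈ ι y → x ≡ y
    ι-injective {x} {y} = toℕ-injective ∘ residue-unique (toℕ<n x) (toℕ<n y)

    opaque
      residue : ℤ → Fin m
      residue a = fromℕ< (n%ℕd<d a m)

      ι-residue : ∀ a → ι (residue a) ≈ a
      ι-residue a = ≈-trans (≈-reflexive (cong +_ (toℕ-fromℕ< (n%ℕd<d a m)))) (≈-sym (≈-%ℕ a))

    ι≈⇒≡residue : ∀ {x a} → ι x ≈ a → x ≡ residue a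
    ι≈⇒≡residue {x} {a} ιx≈a = ι-injective (≈-trans ιx≈a (≈-sym (ι-residue a)))

    residue≡⇒≈ : ∀ {a b} → residue a ≡ residue b → a ≈ b
    residue≡⇒≈ {a} {b} eq = ≈-trans (≈-sym (ι-residue a)) (≈-trans (≈-reflexive (cong ι eq)) (ι-residue b))

module PrimeField (p : ℕ) .{{_ : NonZero p}} (prime : Prime p) where

  import Data.Nat as ℕ
  import Data.Nat.Divisibility as ℕ
  open import Data.Nat.Base using (nonTrivial⇒n>1)
  open import Data.Nat.Primality using (euclidsLemma; prime⇒nonTrivial)
  open import Data.Nat.Coprimality using (Coprime; prime⇒coprime; coprime-Bézout)
  open import Data.Nat.GCD using (module Bézout)
  open import Data.Integer using (_+_; _*_; _-_; ∣_∣; 0ℤ; 1ℤ)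
  import Data.Integer.Properties as ℤ
  open import Data.Integer.DivMod using (n%ℕd<d)
  open import Data.Integer.Divisibility.Signed using (∣⇒∣ᵤ; ∣ᵤ⇒∣)
  open import Data.Integer.Tactic.RingSolver using (solve-∀)
  open import Data.Product using (Σ; _,_; proj₁; proj₂; map₂)
  import Data.Sum as Sum
  open import Data.Sum using ([_,_])
  open import Data.Empty using (⊥-elim)
  open import Function using (_∘_)
  open import Relation.Nullary using (yes; no)
  open import Relation.Binary.PropositionalEquality using (cong; subst; module ≡-Reasoning)

  open Congruence p public

  1≉0 : 1ℤ ≉ 0ℤ
  1≉0 = small≉0 (ℕ.s≤s ℕ.z≤n) (nonTrivial⇒n>1 p {{prime⇒nonTrivial prime}})

  *≈0⇒≈0⊎≈0 : ∀ a b → a * b ≈ 0ℤ → a ≈ 0ℤ ⊎ b ≈ 0ℤ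
  *≈0⇒≈0⊎≈0 a b ab≈0 = Sum.map (∣⇒≈0 ∘ ∣ᵤ⇒∣) (∣⇒≈0 ∘ ∣ᵤ⇒∣)
    (euclidsLemma ∣ a ∣ ∣ b ∣ prime (subst (p ℕ.∣_) (ℤ.abs-* a b) (∣⇒∣ᵤ (≈0⇒∣ ab≈0))))

  ≉0-* : ∀ {a b} → a ≉ 0ℤ → b ≉ 0ℤ → a * b ≉ 0ℤ
  ≉0-* {a} {b} a≉0 b≉0 = [ a≉0 , b≉0 ] ∘ *≈0⇒≈0⊎≈0 a b

  *-cancelʳ : ∀ {a b c} → c ≉ 0ℤ → a * c ≈ b * c → a ≈ b
  *-cancelʳ {a} {b} {c} c≉0 ac≈bc =
    [ (λ a-b≈0 → ≈-lincomb₁ a-b≈0 1ℤ (lemma₂ a b)) , ⊥-elim ∘ c≉0 ]′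
    (*≈0⇒≈0⊎≈0 (a - b) c (≈-lincomb₁ ac≈bc 1ℤ (lemma₁ a b c)))
    where
    lemma₁ : ∀ a b c → (a - b) * c - 0ℤ ≡ 1ℤ * (a * c - b * c)
    lemma₁ = solve-∀
    lemma₂ : ∀ a b → a - b ≡ 1ℤ * (a - b - 0ℤ)
    lemma₂ = solve-∀

  bézout⇒inverse : ∀ {r} → Bézout.Identity 1 p r → Σ ℤ λ w → + r * w ≈ 1ℤ
  bézout⇒inverse {r} (Bézout.+- x y 1+yr≡xp) = - + y , ≈-trans (≈-reflexive r*-y≡1-xp) (+*modulus≈ 1ℤ (- + x))
    where
    open ≡-Reasoning
    r*-y≡1-xp : + r * - + y ≡ 1ℤ + - + x * + p
    r*-y≡1-xp = begin
      + r * - + y             ≡⟨ lemma₁ (+ r) (+ y) ⟩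
      1ℤ - (1ℤ + + y * + r)   ≡⟨ cong (λ t → 1ℤ - (1ℤ + t)) (ℤ.pos-* y r) ⟨
      1ℤ - + (1 ℕ.+ y ℕ.* r)  ≡⟨ cong (λ t → 1ℤ - + t) 1+yr≡xp ⟩
      1ℤ - + (x ℕ.* p)        ≡⟨ cong (λ t → 1ℤ - t) (ℤ.pos-* x p) ⟩
      1ℤ - + x * + p          ≡⟨ lemma₂ (+ x) (+ p) ⟩
      1ℤ + - + x * + p        ∎
      where lemma₁ : ∀ r y → r * - y ≡ 1ℤ - (1ℤ + y * r)
            lemma₁ = solve-∀
            lemma₂ : ∀ x p → 1ℤ - x * p ≡ 1ℤ + - x * p
            lemma₂ = solve-∀
  bézout⇒inverse {r} (Bézout.-+ x y 1+xp≡yr) = + y , ≈-trans (≈-reflexive r*y≡1+xp) (+*modulus≈ 1ℤ (+ x))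
    where
    open ≡-Reasoning
    r*y≡1+xp : + r * + y ≡ 1ℤ + + x * + p
    r*y≡1+xp = begin
      + r * + y               ≡⟨ ℤ.*-comm (+ r) (+ y) ⟩
      + y * + r               ≡⟨ ℤ.pos-* y r ⟨
      + (y ℕ.* r)             ≡⟨ cong +_ 1+xp≡yr ⟨
      + (1 ℕ.+ x ℕ.* p)       ≡⟨ cong (λ t → 1ℤ + t) (ℤ.pos-* x p) ⟩
      1ℤ + + x * + p          ∎

  inverse : ∀ a → a ≉ 0ℤ → Σ ℤ λ w → a * w ≈ 1ℤ
  inverse a a≉0 = map₂ (≈-trans (*-cong (≈-%ℕ a) ≈-refl)) (bézout⇒inverse (coprime-Bézout p-coprime-r))
    where
    r≢0 : NonZero (a %ℕ p)
    r≢0 = ℕ.≢-nonZero (λ r≡0 → a≉0 (≈-trans (≈-%ℕ a) (≈-reflexive (cong +_ r≡0))))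
    p-coprime-r : Coprime p (a %ℕ p)
    p-coprime-r = prime⇒coprime prime {{r≢0}} (n%ℕd<d a p)

  infix 8 _⁻¹

  opaque
    _⁻¹ : ℤ → ℤ
    a ⁻¹ with a ≈? 0ℤ
    ... | yes _  = 0ℤ
    ... | no a≉0 = proj₁ (inverse a a≉0)

    ⁻¹-≈0 : ∀ {a} → a ≈ 0ℤ → a ⁻¹ ≈ 0ℤ
    ⁻¹-≈0 {a} a≈0 with a ≈? 0ℤ
    ... | yes _   = ≈-refl
    ... | no a≉0 = ⊥-elim (a≉0 a≈0)

    *-inverseʳ : ∀ {a} → a ≉ 0ℤ → a * a ⁻¹ ≈ 1ℤ
    *-inverseʳ {a} a≉0 with a ≈? 0ℤ
    ... | yes a≈0  = ⊥-elim (a≉0 a≈0)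
    ... | no a≉0′ = proj₂ (inverse a a≉0′)

module CubeRootOfUnity (p : ℕ) .{{_ : NonZero p}} (prime : Prime p) where

  import Data.Nat as ℕ
  import Data.Nat.Properties as ℕ
  open import Data.Nat.DivMod using ([m+kn]%n≡m%n)
  open import Data.Integer using (_+_; _*_; _-_; 0ℤ; 1ℤ)
  import Data.Integer.Properties as ℤ
  open import Data.Integer.Tactic.RingSolver using (solve-∀)
  open import Data.Fin using (Fin)
  open import Data.Fin.Properties using (_≟_; any?)
  open import Data.List using ([]; _∷_)
  open import Data.List.Relation.Unary.All using ([]; _∷_)
  open import Data.List.Relation.Unary.Any using (here; there)
  open import Data.List.Relation.Unary.Unique.Propositional using ([]; _∷_)
  open import Data.List.Membership.Propositional using (_∈_)
  open import Data.Product using (Σ; _,_)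
  open import Data.Empty using (⊥-elim)
  open import Function using (_∘_)
  open import Relation.Nullary using (yes; no)
  open import Relation.Nullary.Decidable using (_×-dec_; ¬?)
  open import Relation.Binary.PropositionalEquality using (sym; trans; cong; subst)

  open Counting
  open PrimeField p prime

  1-x≉0 : ∀ {x} → x ≉ 1ℤ → 1ℤ - x ≉ 0ℤ
  1-x≉0 {x} x≉1 1-x≈0 = x≉1 (≈-lincomb₁ 1-x≈0 (- 1ℤ) (lemma x))
    where lemma : ∀ x → x - 1ℤ ≡ - 1ℤ * (1ℤ - x - 0ℤ)
          lemma = solve-∀

  -- The Möbius map x ↦ 1/(1 − x) permutes 0, 1, ∞ cyclically; here it fixes 0 and 1 instead.
  opaque
    σ : Fin p → Fin p
    σ x with ι x ≈? 0ℤ | ι x ≈? 1ℤ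
    ... | yes _ | _     = x
    ... | no _  | yes _ = x
    ... | no _  | no _  = residue ((1ℤ - ι x) ⁻¹)

    σ-fixes-0-1 : ∀ x → ι x ≈ 0ℤ ⊎ ι x ≈ 1ℤ → σ x ≡ x
    σ-fixes-0-1 x x≈0⊎x≈1 with ι x ≈? 0ℤ | ι x ≈? 1ℤ | x≈0⊎x≈1
    ... | yes _  | _      | _        = refl
    ... | no _   | yes _  | _        = refl
    ... | no x≉0 | no _   | inj₁ x≈0 = ⊥-elim (x≉0 x≈0)
    ... | no _   | no x≉1 | inj₂ x≈1 = ⊥-elim (x≉1 x≈1)

    σ*[1-x]≈1 : ∀ x → ι x ≉ 0ℤ → ι x ≉ 1ℤ → ι (σ x) * (1ℤ - ι x) ≈ 1ℤ
    σ*[1-x]≈1 x x≉0 x≉1 with ι x ≈? 0ℤ | ι x ≈? 1ℤ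
    ... | yes x≈0 | _       = ⊥-elim (x≉0 x≈0)
    ... | no _    | yes x≈1 = ⊥-elim (x≉1 x≈1)
    ... | no _    | no _    = ≈-trans (*-cong (ι-residue ((1ℤ - ι x) ⁻¹)) (≈-refl {1ℤ - ι x}))
      (≈-trans (≈-reflexive (ℤ.*-comm ((1ℤ - ι x) ⁻¹) (1ℤ - ι x))) (*-inverseʳ (1-x≉0 x≉1)))

  σ≉0 : ∀ x → ι x ≉ 0ℤ → ι x ≉ 1ℤ → ι (σ x) ≉ 0ℤ
  σ≉0 x x≉0 x≉1 σx≈0 = 1≉0 (≈-lincomb₂ (σ*[1-x]≈1 x x≉0 x≉1) σx≈0 (- 1ℤ) (1ℤ - ι x) (lemma (ι x) (ι (σ x))))
    where lemma : ∀ x y → 1ℤ - 0ℤ ≡ - 1ℤ * (y * (1ℤ - x) - 1ℤ) + (1ℤ - x) * (y - 0ℤ)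
          lemma = solve-∀

  σ≉1 : ∀ x → ι x ≉ 0ℤ → ι x ≉ 1ℤ → ι (σ x) ≉ 1ℤ
  σ≉1 x x≉0 x≉1 σx≈1 = x≉0 (≈-lincomb₂ (σ*[1-x]≈1 x x≉0 x≉1) σx≈1 (- 1ℤ) (1ℤ - ι x) (lemma (ι x) (ι (σ x))))
    where lemma : ∀ x y → x - 0ℤ ≡ - 1ℤ * (y * (1ℤ - x) - 1ℤ) + (1ℤ - x) * (y - 1ℤ)
          lemma = solve-∀

  σ³≡id : ∀ x → σ (σ (σ x)) ≡ x
  σ³≡id x with ι x ≈? 0ℤ | ι x ≈? 1ℤ
  ... | yes x≈0 | _       = trans (cong (σ ∘ σ) σx≡x) (trans (cong σ σx≡x) σx≡x)
    where σx≡x = σ-fixes-0-1 x (inj₁ x≈0)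
  ... | no _    | yes x≈1 = trans (cong (σ ∘ σ) σx≡x) (trans (cong σ σx≡x) σx≡x)
    where σx≡x = σ-fixes-0-1 x (inj₂ x≈1)
  ... | no x≉0  | no x≉1  = ι-injective (*-cancelʳ (1-x≉0 z≉1) (≈-trans (σ*[1-x]≈1 z z≉0 z≉1) (≈-sym x*[1-z]≈1)))
    where
    y = σ x
    z = σ y
    y≉0 = σ≉0 x x≉0 x≉1
    y≉1 = σ≉1 x x≉0 x≉1
    z≉0 = σ≉0 y y≉0 y≉1
    z≉1 = σ≉1 y y≉0 y≉1
    x*[1-z]≈1 : ι x * (1ℤ - ι z) ≈ 1ℤ
    x*[1-z]≈1 = ≈-lincomb₂ (σ*[1-x]≈1 y y≉0 y≉1) (σ*[1-x]≈1 x x≉0 x≉1) (1ℤ - ι x) (ι z) (lemma (ι x) (ι y) (ι z))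
      where lemma : ∀ x y z → x * (1ℤ - z) - 1ℤ ≡ (1ℤ - x) * (z * (1ℤ - y) - 1ℤ) + z * (y * (1ℤ - x) - 1ℤ)
            lemma = solve-∀

  fixed-point-is-0-or-1 : (∀ x → ι x ≉ 0ℤ → ι x ≉ 1ℤ → ¬ σ x ≡ x) →
                          ∀ x → σ x ≡ x → x ∈ residue 0ℤ ∷ residue 1ℤ ∷ []
  fixed-point-is-0-or-1 only-0-1 x σx≡x with ι x ≈? 0ℤ | ι x ≈? 1ℤ
  ... | yes x≈0 | _       = here (ι≈⇒≡residue x≈0)
  ... | no _    | yes x≈1 = there (here (ι≈⇒≡residue x≈1))
  ... | no x≉0  | no x≉1  = ⊥-elim (only-0-1 x x≉0 x≉1 σx≡x)

  ∑fix-σ≡2 : (∀ x → ι x ≉ 0ℤ → ι x ≉ 1ℤ → ¬ σ x ≡ x) → ∑fix σ (λ _ → 1) ≡ 2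
  ∑fix-σ≡2 only-0-1 = trans (sum-cong-≗ (λ x → ℕ.*-identityˡ (𝟙 (σ x ≟ x))))
    (∑-𝟙≡length (λ x → σ x ≟ x) (residue 0ℤ ∷ residue 1ℤ ∷ []) ((0≢1 ∷ []) ∷ [] ∷ [])
      (fixed-point-is-0-or-1 only-0-1) (σ-fixes-0-1 _ (inj₁ (ι-residue 0ℤ)) ∷ σ-fixes-0-1 _ (inj₂ (ι-residue 1ℤ)) ∷ []))
    where
    0≢1 : ¬ residue 0ℤ ≡ residue 1ℤ
    0≢1 = 1≉0 ∘ ≈-sym ∘ residue≡⇒≈

  cube-root-of-unity : p ℕ.% 3 ≡ 1 → Σ ℤ λ ω → ω * ω + ω + 1ℤ ≈ 0ℤ
  cube-root-of-unity p%3≡1 with any? (λ x → ¬? (ι x ≈? 0ℤ) ×-dec ¬? (ι x ≈? 1ℤ) ×-dec σ x ≟ x)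
  ... | yes (x , x≉0 , x≉1 , σx≡x) = - ι x , ≈-lincomb₁ x*[1-x]≈1 (- 1ℤ) (lemma (ι x))
    where
    x*[1-x]≈1 : ι x * (1ℤ - ι x) ≈ 1ℤ
    x*[1-x]≈1 = subst (λ y → ι y * (1ℤ - ι x) ≈ 1ℤ) σx≡x (σ*[1-x]≈1 x x≉0 x≉1)
    lemma : ∀ x → - x * - x + - x + 1ℤ - 0ℤ ≡ - 1ℤ * (x * (1ℤ - x) - 1ℤ)
    lemma = solve-∀
  ... | no no-other-fixed-point =
    let k , ∑1≡fix+3k = ∑≡∑fix+3* σ (λ _ → 1) (λ _ → refl) σ³≡id
        p≡2+3k        = trans (sym (∑-const-1 p))
                              (trans ∑1≡fix+3k (cong (ℕ._+ 3 ℕ.* k) (∑fix-σ≡2 only-0-1)))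
    in  ⊥-elim (1≢2 (trans (sym p%3≡1) (trans (cong (ℕ._% 3) p≡2+3k) ([2+3k]%3≡2 k))))
    where
    only-0-1 : ∀ x → ι x ≉ 0ℤ → ι x ≉ 1ℤ → ¬ σ x ≡ x
    only-0-1 x x≉0 x≉1 σx≡x = no-other-fixed-point (x , x≉0 , x≉1 , σx≡x)
    [2+3k]%3≡2 : ∀ k → (2 ℕ.+ 3 ℕ.* k) ℕ.% 3 ≡ 2
    [2+3k]%3≡2 k = trans (cong (λ t → (2 ℕ.+ t) ℕ.% 3) (ℕ.*-comm 3 k)) ([m+kn]%n≡m%n 2 k 3)
    1≢2 : ¬ 1 ≡ 2
    1≢2 ()

  module PrimitiveCubeRoot (3≉0 : + 3 ≉ 0ℤ) (ω : ℤ) (ω-root : ω * ω + ω + 1ℤ ≈ 0ℤ) where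

    ω³≈1 : ω * ω * ω ≈ 1ℤ
    ω³≈1 = ≈-lincomb₁ ω-root (ω - 1ℤ) (lemma ω)
      where lemma : ∀ ω → ω * ω * ω - 1ℤ ≡ (ω - 1ℤ) * (ω * ω + ω + 1ℤ - 0ℤ)
            lemma = solve-∀

    ω-1≉0 : ω - 1ℤ ≉ 0ℤ
    ω-1≉0 ω-1≈0 = 3≉0 (≈-lincomb₂ ω-root ω-1≈0 1ℤ (- (ω + + 2)) (lemma ω))
      where lemma : ∀ ω → + 3 - 0ℤ ≡ 1ℤ * (ω * ω + ω + 1ℤ - 0ℤ) + - (ω + + 2) * (ω - 1ℤ - 0ℤ)
            lemma = solve-∀

    ω≉0 : ω ≉ 0ℤ
    ω≉0 ω≈0 = 1≉0 (≈-lincomb₂ ω-root ω≈0 1ℤ (- (ω + 1ℤ)) (lemma ω))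
      where lemma : ∀ ω → 1ℤ - 0ℤ ≡ 1ℤ * (ω * ω + ω + 1ℤ - 0ℤ) + - (ω + 1ℤ) * (ω - 0ℤ)
            lemma = solve-∀

    ω+1≉0 : ω + 1ℤ ≉ 0ℤ
    ω+1≉0 ω+1≈0 = 1≉0 (≈-lincomb₂ ω-root ω+1≈0 1ℤ (- ω) (lemma ω))
      where lemma : ∀ ω → 1ℤ - 0ℤ ≡ 1ℤ * (ω * ω + ω + 1ℤ - 0ℤ) + - ω * (ω + 1ℤ - 0ℤ)
            lemma = solve-∀

    [2ω+1]²≈-3 : (+ 2 * ω + 1ℤ) * (+ 2 * ω + 1ℤ) ≈ - + 3
    [2ω+1]²≈-3 = ≈-lincomb₁ ω-root (+ 4) (lemma ω)
      where lemma : ∀ ω → (+ 2 * ω + 1ℤ) * (+ 2 * ω + 1ℤ) - - + 3 ≡ + 4 * (ω * ω + ω + 1ℤ - 0ℤ)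
            lemma = solve-∀

module Squares (p : ℕ) .{{_ : NonZero p}} (prime : Prime p) where

  import Data.Nat as ℕ
  open import Data.Integer using (_+_; _*_; _-_; 0ℤ; 1ℤ)
  open import Data.Integer.Tactic.RingSolver using (solve-∀)
  open import Data.Fin using (Fin)
  open import Data.Fin.Properties using (any?)
  open import Data.List using ([]; _∷_)
  open import Data.List.Relation.Unary.All using ([]; _∷_)
  open import Data.List.Relation.Unary.Any using (here; there)
  open import Data.List.Relation.Unary.Unique.Propositional using ([]; _∷_)
  open import Data.List.Membership.Propositional using (_∈_)
  open import Data.Product using (∃; _,_)
  open import Data.Sum using ([_,_])
  open import Data.Empty using (⊥-elim)
  open import Function using (id)
  open import Relation.Nullary using (Dec; yes; no)
  open import Relation.Nullary.Decidable using (_×-dec_; ¬?)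
  open import Relation.Binary.PropositionalEquality using (cong)

  open Counting
  open PrimeField p prime

  #√ : ℤ → ℕ
  #√ c = ∑ (λ y → 𝟙 (ι y * ι y ≈? c))

  #√-cong : ∀ {c c'} → c ≈ c' → #√ c ≡ #√ c'
  #√-cong {c} {c'} c≈c' = sum-cong-≗ λ y →
    𝟙-⇔ (ι y * ι y ≈? c) (ι y * ι y ≈? c') (λ y²≈c → ≈-trans y²≈c c≈c') (λ y²≈c' → ≈-trans y²≈c' (≈-sym c≈c'))

  IsNonzeroSquare : ℤ → Set
  IsNonzeroSquare c = c ≉ 0ℤ × ∃ λ y → ι y * ι y ≈ c

  opaque
    isNonzeroSquare? : ∀ c → Dec (IsNonzeroSquare c)
    isNonzeroSquare? c = ¬? (c ≈? 0ℤ) ×-dec any? (λ y → ι y * ι y ≈? c)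

  square≈0⇒≈0 : ∀ {y} → y * y ≈ 0ℤ → y ≈ 0ℤ
  square≈0⇒≈0 {y} y²≈0 = [ id , id ]′ (*≈0⇒≈0⊎≈0 y y y²≈0)

  module _ (2≉0 : + 2 ≉ 0ℤ) where

    #√≡ : ∀ c → #√ c ≡ 𝟙 (c ≈? 0ℤ) ℕ.+ 2 ℕ.* 𝟙 (isNonzeroSquare? c)
    #√≡ c with c ≈? 0ℤ | isNonzeroSquare? c
    ... | yes c≈0 | yes (c≉0 , _) = ⊥-elim (c≉0 c≈0)
    ... | yes c≈0 | no _ = ∑-𝟙≡length (λ y → ι y * ι y ≈? c) (residue 0ℤ ∷ []) ([] ∷ [])
      (λ y y²≈c → here (ι≈⇒≡residue (square≈0⇒≈0 (≈-trans y²≈c c≈0))))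
      (≈-trans (*-cong (ι-residue 0ℤ) (ι-residue 0ℤ)) (≈-sym c≈0) ∷ [])
    ... | no c≉0 | no not-square = ∑-𝟙≡length (λ y → ι y * ι y ≈? c) [] []
      (λ y y²≈c → ⊥-elim (not-square (c≉0 , y , y²≈c))) []
    ... | no c≉0 | yes (_ , y₀ , y₀²≈c) =
      ∑-𝟙≡length (λ y → ι y * ι y ≈? c) (y₀ ∷ -y₀ ∷ []) ((y₀≢-y₀ ∷ []) ∷ [] ∷ []) roots (y₀²≈c ∷ -y₀²≈c ∷ [])
      where
      -y₀ : Fin p
      -y₀ = residue (- ι y₀)
      -y₀²≈c : ι -y₀ * ι -y₀ ≈ c
      -y₀²≈c = ≈-trans (*-cong (ι-residue (- ι y₀)) (ι-residue (- ι y₀))) (≈-trans (≈-reflexive (lemma (ι y₀))) y₀²≈c)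
        where lemma : ∀ y → - y * - y ≡ y * y
              lemma = solve-∀
      y₀≉0 : ι y₀ ≉ 0ℤ
      y₀≉0 y₀≈0 = c≉0 (≈-trans (≈-sym y₀²≈c) (*-cong y₀≈0 y₀≈0))
      y₀≢-y₀ : ¬ y₀ ≡ -y₀
      y₀≢-y₀ y₀≡-y₀ = [ 2≉0 , y₀≉0 ] (*≈0⇒≈0⊎≈0 (+ 2) (ι y₀) (≈-lincomb₁ y₀≈-y₀ 1ℤ (lemma (ι y₀))))
        where
        y₀≈-y₀ : ι y₀ ≈ - ι y₀
        y₀≈-y₀ = ≈-trans (≈-reflexive (cong ι y₀≡-y₀)) (ι-residue (- ι y₀))
        lemma : ∀ y → + 2 * y - 0ℤ ≡ 1ℤ * (y - - y)
        lemma = solve-∀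
      roots : ∀ y → ι y * ι y ≈ c → y ∈ y₀ ∷ -y₀ ∷ []
      roots y y²≈c = [ (λ y-y₀≈0 → here (ι-injective (≈-lincomb₁ y-y₀≈0 1ℤ (lemma₁ (ι y) (ι y₀)))))
                     , (λ y+y₀≈0 → there (here (ι≈⇒≡residue (≈-lincomb₁ y+y₀≈0 1ℤ (lemma₂ (ι y) (ι y₀))))))
                     ] (*≈0⇒≈0⊎≈0 (ι y - ι y₀) (ι y + ι y₀) (≈-lincomb₂ y²≈c y₀²≈c 1ℤ (- 1ℤ) (lemma₀ (ι y) (ι y₀) c)))
        where
        lemma₀ : ∀ y y₀ c → (y - y₀) * (y + y₀) - 0ℤ ≡ 1ℤ * (y * y - c) + - 1ℤ * (y₀ * y₀ - c)
        lemma₀ = solve-∀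
        lemma₁ : ∀ y y₀ → y - y₀ ≡ 1ℤ * (y - y₀ - 0ℤ)
        lemma₁ = solve-∀
        lemma₂ : ∀ y y₀ → y - - y₀ ≡ 1ℤ * (y + y₀ - 0ℤ)
        lemma₂ = solve-∀

  nonzeroSquare-rescale : ∀ {c c' s t} → c * (s * s) ≈ c' * (t * t) → s ≉ 0ℤ → t ≉ 0ℤ →
                          IsNonzeroSquare c → IsNonzeroSquare c'
  nonzeroSquare-rescale {c} {c'} {s} {t} cs²≈c't² s≉0 t≉0 (c≉0 , y , y²≈c) =
    c'≉0 , residue y' , ≈-trans (*-cong (ι-residue y') (ι-residue y')) y'²≈c'
    where
    y' : ℤ
    y' = ι y * s * t ⁻¹
    c'≉0 : c' ≉ 0ℤ
    c'≉0 c'≈0 = ≉0-* c≉0 (≉0-* s≉0 s≉0) (≈-lincomb₂ cs²≈c't² c'≈0 1ℤ (t * t) (lemma c c' s t))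
      where lemma : ∀ c c' s t → c * (s * s) - 0ℤ ≡ 1ℤ * (c * (s * s) - c' * (t * t)) + t * t * (c' - 0ℤ)
            lemma = solve-∀
    y'²≈c' : y' * y' ≈ c'
    y'²≈c' = ≈-lincomb₃ y²≈c cs²≈c't² (*-inverseʳ t≉0)
               ((s * t ⁻¹) * (s * t ⁻¹)) (t ⁻¹ * t ⁻¹) (c' * (t * t ⁻¹ + 1ℤ)) (lemma (ι y) s (t ⁻¹) c c' t)
      where lemma : ∀ y s i c c' t → (y * s * i) * (y * s * i) - c' ≡ (s * i) * (s * i) * (y * y - c)
                      + i * i * (c * (s * s) - c' * (t * t)) + c' * (t * i + 1ℤ) * (t * i - 1ℤ)
            lemma = solve-∀

  𝟙-nonzeroSquare-rescale : ∀ {c c' s t} → c * (s * s) ≈ c' * (t * t) → s ≉ 0ℤ → t ≉ 0ℤ →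
                            𝟙 (isNonzeroSquare? c) ≡ 𝟙 (isNonzeroSquare? c')
  𝟙-nonzeroSquare-rescale {c} {c'} cs²≈c't² s≉0 t≉0 = 𝟙-⇔ (isNonzeroSquare? c) (isNonzeroSquare? c')
    (nonzeroSquare-rescale cs²≈c't² s≉0 t≉0) (nonzeroSquare-rescale (≈-sym cs²≈c't²) t≉0 s≉0)

module Curve (p : ℕ) .{{_ : NonZero p}} (prime : Prime p) where

  import Data.Nat as ℕ
  import Data.Nat.Properties as ℕ
  open import Data.Integer using (_+_; _*_; _-_; 0ℤ; 1ℤ)
  import Data.Integer.Properties as ℤ
  open import Data.Integer.Tactic.RingSolver using (solve-∀)
  open import Data.Fin using (Fin)
  open import Data.Fin.Properties using (_≟_)
  open import Data.List using ([]; _∷_)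
  open import Data.List.Relation.Unary.All using ([]; _∷_)
  open import Data.List.Relation.Unary.Any using (here; there)
  open import Data.List.Relation.Unary.Unique.Propositional using ([]; _∷_)
  open import Data.List.Membership.Propositional using (_∈_)
  open import Data.Product using (∃; _,_; proj₁; proj₂)
  open import Data.Sum using ([_,_])
  open import Data.Empty using (⊥-elim)
  open import Function using (_∘_; id)
  open import Relation.Nullary using (yes; no)
  open import Relation.Binary.PropositionalEquality using (sym; trans; cong; cong₂; subst; module ≡-Reasoning)

  open Counting
  open PrimeField p prime
  open CubeRootOfUnity p prime
  open Squares p prime

  module _ (2≉0 : + 2 ≉ 0ℤ) (3≉0 : + 3 ≉ 0ℤ) (ω : ℤ) (ω-root : ω * ω + ω + 1ℤ ≈ 0ℤ)
           (A : ℤ) (A≉0 : A ≉ 0ℤ) where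

    open PrimitiveCubeRoot 3≉0 ω ω-root

    F : ℤ → ℤ
    F X = X * X * X + A * A * A

    F-cong : ∀ {X Y} → X ≈ Y → F X ≈ F Y
    F-cong X≈Y = +-cong (*-cong (*-cong X≈Y X≈Y) X≈Y) (≈-refl {A * A * A})

    #affine : ℕ
    #affine = ∑ (λ x → #√ (F (ι x)))

    A³≉0 : A * A * A ≉ 0ℤ
    A³≉0 = ≉0-* (≉0-* A≉0 A≉0) A≉0

    rotate : Fin p → Fin p
    rotate x = residue (ω * ι x)

    rotate³≡id : ∀ x → rotate (rotate (rotate x)) ≡ x
    rotate³≡id x = ι-injective (begin
      ι (rotate (rotate (rotate x))) ≈⟨ ι-residue (ω * ι (rotate (rotate x))) ⟩
      ω * ι (rotate (rotate x))      ≈⟨ *-cong (≈-refl {ω}) (ι-residue (ω * ι (rotate x))) ⟩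
      ω * (ω * ι (rotate x))         ≈⟨ *-cong (≈-refl {ω}) (*-cong (≈-refl {ω}) (ι-residue (ω * ι x))) ⟩
      ω * (ω * (ω * ι x))            ≈⟨ ≈-lincomb₁ ω³≈1 (ι x) (lemma ω (ι x)) ⟩
      ι x                            ∎)
      where
      open ≈-Reasoning
      lemma : ∀ ω X → ω * (ω * (ω * X)) - X ≡ X * (ω * ω * ω - 1ℤ)
      lemma = solve-∀

    #√F∘rotate : ∀ x → #√ (F (ι (rotate x))) ≡ #√ (F (ι x))
    #√F∘rotate x = #√-cong (begin
      F (ι (rotate x)) ≈⟨ F-cong (ι-residue (ω * ι x)) ⟩
      F (ω * ι x)      ≈⟨ ≈-lincomb₁ ω³≈1 (ι x * ι x * ι x) (lemma ω (ι x) A) ⟩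
      F (ι x)          ∎)
      where
      open ≈-Reasoning
      lemma : ∀ ω X A → (ω * X) * (ω * X) * (ω * X) + A * A * A - (X * X * X + A * A * A) ≡ X * X * X * (ω * ω * ω - 1ℤ)
      lemma = solve-∀

    rotate-fixed⇒0 : ∀ x → rotate x ≡ x → x ≡ residue 0ℤ
    rotate-fixed⇒0 x rotate-x≡x =
      [ ⊥-elim ∘ ω-1≉0 , ι≈⇒≡residue ] (*≈0⇒≈0⊎≈0 (ω - 1ℤ) (ι x) (≈-lincomb₁ ωx≈x 1ℤ (lemma ω (ι x))))
      where
      ωx≈x : ω * ι x ≈ ι x
      ωx≈x = ≈-trans (≈-sym (ι-residue (ω * ι x))) (≈-reflexive (cong ι rotate-x≡x))
      lemma : ∀ ω X → (ω - 1ℤ) * X - 0ℤ ≡ 1ℤ * (ω * X - X)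
      lemma = solve-∀

    rotate-0 : rotate (residue 0ℤ) ≡ residue 0ℤ
    rotate-0 = ι≈⇒≡residue (begin
      ι (rotate (residue 0ℤ))  ≈⟨ ι-residue (ω * ι (residue 0ℤ)) ⟩
      ω * ι (residue 0ℤ)       ≈⟨ *-cong (≈-refl {ω}) (ι-residue 0ℤ) ⟩
      ω * 0ℤ                   ≈⟨ ≈-reflexive (ℤ.*-zeroʳ ω) ⟩
      0ℤ                       ∎)
      where open ≈-Reasoning

    #affine≡2e+3k : ∃ λ k → #affine ≡ 2 ℕ.* 𝟙 (isNonzeroSquare? (A * A * A)) ℕ.+ 3 ℕ.* k
    #affine≡2e+3k =
      let k , #affine≡fixed+3k = ∑≡∑fix+3* rotate (λ x → #√ (F (ι x))) #√F∘rotate rotate³≡id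
      in  k , trans #affine≡fixed+3k (cong (ℕ._+ 3 ℕ.* k) fixed-part)
      where
      open ≡-Reasoning
      0′ = residue 0ℤ
      fixed-part : ∑fix rotate (λ x → #√ (F (ι x))) ≡ 2 ℕ.* 𝟙 (isNonzeroSquare? (A * A * A))
      fixed-part = begin
        ∑ (λ x → #√ (F (ι x)) ℕ.* 𝟙 (rotate x ≟ x))
          ≡⟨ sum-cong-≗ (λ x → cong (#√ (F (ι x)) ℕ.*_)
               (𝟙-⇔ (rotate x ≟ x) (x ≟ 0′) (rotate-fixed⇒0 x) λ { refl → rotate-0 })) ⟩
        ∑ (λ x → #√ (F (ι x)) ℕ.* 𝟙 (x ≟ 0′))
          ≡⟨ ∑-select (λ x → #√ (F (ι x))) 0′ ⟩
        #√ (F (ι 0′))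
          ≡⟨ #√-cong (≈-trans (F-cong (ι-residue 0ℤ)) (≈-reflexive (lemma A))) ⟩
        #√ (A * A * A)
          ≡⟨ #√≡ 2≉0 (A * A * A) ⟩
        𝟙 (A * A * A ≈? 0ℤ) ℕ.+ 2 ℕ.* 𝟙 (isNonzeroSquare? (A * A * A))
          ≡⟨ cong (ℕ._+ 2 ℕ.* 𝟙 (isNonzeroSquare? (A * A * A))) (𝟙-no (A * A * A ≈? 0ℤ) A³≉0) ⟩
        2 ℕ.* 𝟙 (isNonzeroSquare? (A * A * A)) ∎
        where lemma : ∀ A → 0ℤ * 0ℤ * 0ℤ + A * A * A ≡ A * A * A
              lemma = solve-∀

    B : ℤ
    B = + 3 * A * A

    B≉0 : B ≉ 0ℤ
    B≉0 = ≉0-* (≉0-* 3≉0 A≉0) A≉0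

    g : ℤ → ℤ
    g U = U * (U * U - + 3 * A * U + B)

    F≡g : ∀ X → F X ≡ g (X + A)
    F≡g X = lemma X A
      where lemma : ∀ X A → X * X * X + A * A * A ≡ (X + A) * ((X + A) * (X + A) - + 3 * A * (X + A) + + 3 * A * A)
            lemma = solve-∀

    g-cong : ∀ {U V} → U ≈ V → g U ≈ g V
    g-cong U≈V = *-cong U≈V (+-cong (+-cong (*-cong U≈V U≈V) (-‿cong (*-cong (≈-refl {+ 3 * A}) U≈V)))
                                   (≈-refl {B}))

    g≈0 : ∀ {U} → U ≈ 0ℤ → g U ≈ 0ℤ
    g≈0 {U} U≈0 = ≈-lincomb₁ U≈0 (U * U - + 3 * A * U + B) (lemma U (U * U - + 3 * A * U + B))
      where lemma : ∀ U V → U * V - 0ℤ ≡ V * (U - 0ℤ)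
            lemma = solve-∀

    u : Fin p → ℤ
    u x = ι x + A

    u-injective : ∀ {x y} → u x ≈ u y → x ≡ y
    u-injective {x} {y} ux≈uy = ι-injective (≈-lincomb₁ ux≈uy 1ℤ (lemma (ι x) (ι y) A))
      where lemma : ∀ X Y A → X - Y ≡ 1ℤ * (X + A - (Y + A))
            lemma = solve-∀

    h : Fin p → ℕ
    h x = 𝟙 (isNonzeroSquare? (F (ι x)))

    h-u≈0 : ∀ x → u x ≈ 0ℤ → h x ≡ 0
    h-u≈0 x ux≈0 = 𝟙-no (isNonzeroSquare? (F (ι x)))
      (λ (F≉0 , _) → F≉0 (≈-trans (≈-reflexive (F≡g (ι x))) (g≈0 ux≈0)))

    -- u ↦ B/u; since 0⁻¹ = 0, it also fixes the point with u = 0.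
    τ : Fin p → Fin p
    τ x = residue (B * u x ⁻¹ - A)

    u∘τ≈B*u⁻¹ : ∀ x → u (τ x) ≈ B * u x ⁻¹
    u∘τ≈B*u⁻¹ x = ≈-lincomb₁ (ι-residue (B * u x ⁻¹ - A)) 1ℤ (lemma (ι (τ x)) A (B * u x ⁻¹))
      where lemma : ∀ R A V → R + A - V ≡ 1ℤ * (R - (V - A))
            lemma = solve-∀

    τ-u≈0 : ∀ x → u x ≈ 0ℤ → τ x ≡ x
    τ-u≈0 x ux≈0 = u-injective (begin
      u (τ x)     ≈⟨ u∘τ≈B*u⁻¹ x ⟩
      B * u x ⁻¹  ≈⟨ *-cong (≈-refl {B}) (⁻¹-≈0 ux≈0) ⟩
      B * 0ℤ      ≈⟨ ≈-reflexive (ℤ.*-zeroʳ B) ⟩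
      0ℤ          ≈⟨ ux≈0 ⟨
      u x         ∎)
      where open ≈-Reasoning

    u∘τ*u≈B : ∀ x → u x ≉ 0ℤ → u (τ x) * u x ≈ B
    u∘τ*u≈B x ux≉0 = ≈-lincomb₂ (u∘τ≈B*u⁻¹ x) (*-inverseʳ ux≉0) (u x) B (lemma (u (τ x)) (u x) B (u x ⁻¹))
      where lemma : ∀ V U B i → V * U - B ≡ U * (V - B * i) + B * (U * i - 1ℤ)
            lemma = solve-∀

    u∘τ≉0 : ∀ x → u x ≉ 0ℤ → u (τ x) ≉ 0ℤ
    u∘τ≉0 x ux≉0 uτx≈0 = B≉0 (begin
      B              ≈⟨ u∘τ*u≈B x ux≉0 ⟨
      u (τ x) * u x  ≈⟨ *-cong uτx≈0 (≈-refl {u x}) ⟩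
      0ℤ * u x       ≈⟨ ≈-reflexive (ℤ.*-zeroˡ (u x)) ⟩
      0ℤ             ∎)
      where open ≈-Reasoning

    τ²≡id : ∀ x → τ (τ x) ≡ x
    τ²≡id x with u x ≈? 0ℤ
    ... | yes ux≈0 = trans (cong τ (τ-u≈0 x ux≈0)) (τ-u≈0 x ux≈0)
    ... | no ux≉0  = u-injective (*-cancelʳ (u∘τ≉0 x ux≉0) (begin
      u (τ (τ x)) * u (τ x) ≈⟨ u∘τ*u≈B (τ x) (u∘τ≉0 x ux≉0) ⟩
      B                     ≈⟨ u∘τ*u≈B x ux≉0 ⟨
      u (τ x) * u x         ≈⟨ ≈-reflexive (ℤ.*-comm (u (τ x)) (u x)) ⟩
      u x * u (τ x)         ∎))
      where open ≈-Reasoning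

    τ-fixed⇒ : ∀ x → τ x ≡ x → u x ≈ 0ℤ ⊎ u x * u x ≈ B
    τ-fixed⇒ x τx≡x with u x ≈? 0ℤ
    ... | yes ux≈0 = inj₁ ux≈0
    ... | no ux≉0  = inj₂ (subst (λ y → u y * u x ≈ B) τx≡x (u∘τ*u≈B x ux≉0))

    τ-fixed⇐ : ∀ x → u x ≈ 0ℤ ⊎ u x * u x ≈ B → τ x ≡ x
    τ-fixed⇐ x (inj₁ ux≈0) = τ-u≈0 x ux≈0
    τ-fixed⇐ x (inj₂ ux²≈B) with u x ≈? 0ℤ
    ... | yes ux≈0 = τ-u≈0 x ux≈0
    ... | no ux≉0  = u-injective (*-cancelʳ ux≉0 (≈-trans (u∘τ*u≈B x ux≉0) (≈-sym ux²≈B)))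

    F∘τ-rescaling : ∀ x → u x ≉ 0ℤ → F (ι (τ x)) * ((u x * u x) * (u x * u x)) ≈ F (ι x) * (B * B)
    F∘τ-rescaling x ux≉0 = begin
      F (ι (τ x)) * ((U * U) * (U * U)) ≈⟨ ≈-reflexive (cong (_* ((U * U) * (U * U))) (F≡g (ι (τ x)))) ⟩
      g (u (τ x)) * ((U * U) * (U * U)) ≈⟨ ≈-lincomb₁ (u∘τ*u≈B x ux≉0) (K A U (u (τ x))) (lemma A U (u (τ x))) ⟩
      g U * (B * B)                     ≈⟨ ≈-reflexive (cong (_* (B * B)) (F≡g (ι x))) ⟨
      F (ι x) * (B * B)                 ∎
      where
      open ≈-Reasoning
      U = u x
      K : ℤ → ℤ → ℤ → ℤ
      K A U U' = U * ((U' * U) * (U' * U) + (U' * U) * (+ 3 * A * A) + (+ 3 * A * A) * (+ 3 * A * A)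
                      - + 3 * A * U * ((U' * U) + (+ 3 * A * A)) + (+ 3 * A * A) * U * U)
      lemma : ∀ A U U' → U' * (U' * U' - + 3 * A * U' + + 3 * A * A) * ((U * U) * (U * U))
                         - U * (U * U - + 3 * A * U + + 3 * A * A) * ((+ 3 * A * A) * (+ 3 * A * A))
                       ≡ U * ((U' * U) * (U' * U) + (U' * U) * (+ 3 * A * A) + (+ 3 * A * A) * (+ 3 * A * A)
                              - + 3 * A * U * ((U' * U) + (+ 3 * A * A)) + (+ 3 * A * A) * U * U)
                         * (U' * U - + 3 * A * A)
      lemma = solve-∀

    h∘τ≡h : ∀ x → h (τ x) ≡ h x
    h∘τ≡h x with u x ≈? 0ℤ
    ... | yes ux≈0 = cong h (τ-u≈0 x ux≈0)
    ... | no ux≉0  = 𝟙-nonzeroSquare-rescale (F∘τ-rescaling x ux≉0) (≉0-* ux≉0 ux≉0) B≉0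

    ρ : Fin p → Fin p
    ρ x = residue (- (+ 2 * A) - ι x)

    u∘ρ≈-u : ∀ x → u (ρ x) ≈ - u x
    u∘ρ≈-u x = ≈-lincomb₁ (ι-residue (- (+ 2 * A) - ι x)) 1ℤ (lemma (ι (ρ x)) A (ι x))
      where lemma : ∀ R A X → R + A - - (X + A) ≡ 1ℤ * (R - (- (+ 2 * A) - X))
            lemma = solve-∀

    u≈-u∘ρ : ∀ x → u x ≈ - u (ρ x)
    u≈-u∘ρ x = ≈-sym (≈-trans (-‿cong (u∘ρ≈-u x)) (≈-reflexive (ℤ.neg-involutive (u x))))

    ρ²≡id : ∀ x → ρ (ρ x) ≡ x
    ρ²≡id x = u-injective (≈-trans (u∘ρ≈-u (ρ x)) (≈-sym (u≈-u∘ρ x)))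

    ρ-fixed⇒u≈0 : ∀ x → ρ x ≡ x → u x ≈ 0ℤ
    ρ-fixed⇒u≈0 x ρx≡x = [ ⊥-elim ∘ 2≉0 , id ] (*≈0⇒≈0⊎≈0 (+ 2) (u x) (≈-lincomb₁ ux≈-ux 1ℤ (lemma (u x))))
      where
      ux≈-ux : u x ≈ - u x
      ux≈-ux = subst (λ y → u x ≈ - u y) ρx≡x (u≈-u∘ρ x)
      lemma : ∀ U → + 2 * U - 0ℤ ≡ 1ℤ * (U - - U)
      lemma = solve-∀

    negation-preserves-τ-fixed : ∀ {U V} → U ≈ - V → V ≈ 0ℤ ⊎ V * V ≈ B → U ≈ 0ℤ ⊎ U * U ≈ B
    negation-preserves-τ-fixed {U} {V} U≈-V (inj₁ V≈0)   = inj₁ (≈-lincomb₂ U≈-V V≈0 1ℤ (- 1ℤ) (lemma U V))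
      where lemma : ∀ U V → U - 0ℤ ≡ 1ℤ * (U - - V) + - 1ℤ * (V - 0ℤ)
            lemma = solve-∀
    negation-preserves-τ-fixed {U} {V} U≈-V (inj₂ V²≈B) = inj₂ (≈-lincomb₂ U≈-V V²≈B (U - V) 1ℤ (lemma U V B))
      where lemma : ∀ U V B → U * U - B ≡ (U - V) * (U - - V) + 1ℤ * (V * V - B)
            lemma = solve-∀

    τ∘ρ-fixed⇔ : ∀ x → (τ x ≡ x → τ (ρ x) ≡ ρ x) × (τ (ρ x) ≡ ρ x → τ x ≡ x)
    τ∘ρ-fixed⇔ x = (λ τx≡x → τ-fixed⇐ (ρ x) (negation-preserves-τ-fixed (u∘ρ≈-u x) (τ-fixed⇒ x τx≡x)))
                 , (λ τρx≡ρx → τ-fixed⇐ x (negation-preserves-τ-fixed (u≈-u∘ρ x) (τ-fixed⇒ (ρ x) τρx≡ρx)))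

    -- For u² = B one has g(u)g(−u) = −27a⁶, and −3 = (2ω + 1)².
    S : ℤ
    S = (+ 2 * ω + 1ℤ) * (+ 3 * (A * A * A))

    S≉0 : S ≉ 0ℤ
    S≉0 = ≉0-* 2ω+1≉0 (≉0-* 3≉0 A³≉0)
      where
      2ω+1≉0 : + 2 * ω + 1ℤ ≉ 0ℤ
      2ω+1≉0 2ω+1≈0 = 3≉0 (≈-lincomb₂ [2ω+1]²≈-3 2ω+1≈0 1ℤ (- (+ 2 * ω + 1ℤ)) (lemma ω))
        where lemma : ∀ ω → + 3 - 0ℤ ≡ 1ℤ * ((+ 2 * ω + 1ℤ) * (+ 2 * ω + 1ℤ) - - + 3)
                                       + - (+ 2 * ω + 1ℤ) * (+ 2 * ω + 1ℤ - 0ℤ)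
              lemma = solve-∀

    g*g∘neg≈S² : ∀ {U} → U * U ≈ B → g U * g (- U) ≈ S * S
    g*g∘neg≈S² {U} U²≈B =
      ≈-lincomb₂ U²≈B [2ω+1]²≈-3 (- ((U * U) * (U * U) + B * B)) (- (+ 9 * (A * A * A) * (A * A * A))) (lemma A U ω)
      where
      lemma : ∀ A U ω → U * (U * U - + 3 * A * U + + 3 * A * A) * (- U * (- U * - U - + 3 * A * - U + + 3 * A * A))
                        - (+ 2 * ω + 1ℤ) * (+ 3 * (A * A * A)) * ((+ 2 * ω + 1ℤ) * (+ 3 * (A * A * A)))
                      ≡ - ((U * U) * (U * U) + (+ 3 * A * A) * (+ 3 * A * A)) * (U * U - + 3 * A * A)
                        + - (+ 9 * (A * A * A) * (A * A * A)) * ((+ 2 * ω + 1ℤ) * (+ 2 * ω + 1ℤ) - - + 3)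
      lemma = solve-∀

    g∘u≉0 : ∀ x → u x * u x ≈ B → g (u x) ≉ 0ℤ
    g∘u≉0 x ux²≈B gU≈0 = ≉0-* S≉0 S≉0 (begin
      S * S                 ≈⟨ g*g∘neg≈S² {u x} ux²≈B ⟨
      g (u x) * g (- u x)   ≈⟨ *-cong gU≈0 (≈-refl {g (- u x)}) ⟩
      0ℤ * g (- u x)        ≈⟨ ≈-reflexive (ℤ.*-zeroˡ (g (- u x))) ⟩
      0ℤ                    ∎)
      where open ≈-Reasoning

    F∘ρ-rescaling : ∀ x → u x * u x ≈ B → F (ι (ρ x)) * (g (u x) * g (u x)) ≈ F (ι x) * (S * S)
    F∘ρ-rescaling x ux²≈B = begin
      F (ι (ρ x)) * (g U * g U) ≈⟨ *-cong F∘ρ≈g[-U] (≈-refl {g U * g U}) ⟩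
      g (- U) * (g U * g U)     ≈⟨ ≈-reflexive (lemma (g U) (g (- U))) ⟩
      (g U * g (- U)) * g U     ≈⟨ *-cong (g*g∘neg≈S² {U} ux²≈B) (≈-refl {g U}) ⟩
      (S * S) * g U             ≈⟨ ≈-reflexive (ℤ.*-comm (S * S) (g U)) ⟩
      g U * (S * S)             ≈⟨ ≈-reflexive (cong (_* (S * S)) (F≡g (ι x))) ⟨
      F (ι x) * (S * S)         ∎
      where
      open ≈-Reasoning
      U = u x
      F∘ρ≈g[-U] : F (ι (ρ x)) ≈ g (- U)
      F∘ρ≈g[-U] = ≈-trans (≈-reflexive (F≡g (ι (ρ x)))) (g-cong (u∘ρ≈-u x))
      lemma : ∀ a b → b * (a * a) ≡ (a * b) * a
      lemma = solve-∀

    h∘ρ≡h : ∀ x → τ x ≡ x → h (ρ x) ≡ h x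
    h∘ρ≡h x τx≡x with τ-fixed⇒ x τx≡x
    ... | inj₁ ux≈0  = trans (h-u≈0 (ρ x) (≈-trans (u∘ρ≈-u x) (-‿cong ux≈0))) (sym (h-u≈0 x ux≈0))
    ... | inj₂ ux²≈B = 𝟙-nonzeroSquare-rescale (F∘ρ-rescaling x ux²≈B) (g∘u≉0 x ux²≈B) S≉0

    weight : Fin p → ℕ
    weight x = h x ℕ.* 𝟙 (τ x ≟ x)

    weight∘ρ≡weight : ∀ x → weight (ρ x) ≡ weight x
    weight∘ρ≡weight x with τ x ≟ x | τ (ρ x) ≟ ρ x
    ... | yes τx≡x | yes _      = cong (ℕ._* 1) (h∘ρ≡h x τx≡x)
    ... | yes τx≡x | no τρx≢ρx  = ⊥-elim (τρx≢ρx (proj₁ (τ∘ρ-fixed⇔ x) τx≡x))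
    ... | no τx≢x  | yes τρx≡ρx = ⊥-elim (τx≢x (proj₂ (τ∘ρ-fixed⇔ x) τρx≡ρx))
    ... | no _     | no _       = trans (ℕ.*-zeroʳ (h (ρ x))) (sym (ℕ.*-zeroʳ (h x)))

    weight-ρ-fixed≡0 : ∀ x → weight x ℕ.* 𝟙 (ρ x ≟ x) ≡ 0
    weight-ρ-fixed≡0 x with ρ x ≟ x
    ... | yes ρx≡x = cong (λ t → t ℕ.* 𝟙 (τ x ≟ x) ℕ.* 1) (h-u≈0 x (ρ-fixed⇒u≈0 x ρx≡x))
    ... | no _     = ℕ.*-zeroʳ (weight x)

    ∑h-even : ∃ λ K → ∑ h ≡ 2 ℕ.* K
    ∑h-even =
      let k , ∑h≡ = ∑≡∑fix+2* τ h h∘τ≡h τ²≡id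
          l , ∑weight≡ = ∑≡∑fix+2* ρ weight weight∘ρ≡weight ρ²≡id
      in  l ℕ.+ k , (begin
        ∑ h                                    ≡⟨ ∑h≡ ⟩
        ∑ weight ℕ.+ 2 ℕ.* k                    ≡⟨ cong (ℕ._+ 2 ℕ.* k) ∑weight≡ ⟩
        ∑fix ρ weight ℕ.+ 2 ℕ.* l ℕ.+ 2 ℕ.* k   ≡⟨ cong (λ t → t ℕ.+ 2 ℕ.* l ℕ.+ 2 ℕ.* k) ∑fix-ρ-weight≡0 ⟩
        2 ℕ.* l ℕ.+ 2 ℕ.* k                     ≡⟨ ℕ.*-distribˡ-+ 2 l k ⟨
        2 ℕ.* (l ℕ.+ k)                         ∎)
      where
      open ≡-Reasoning
      ∑fix-ρ-weight≡0 : ∑fix ρ weight ≡ 0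
      ∑fix-ρ-weight≡0 = trans (sum-cong-≗ weight-ρ-fixed≡0) (sum-replicate-zero p)

    F-factorisation : ∀ X → F X ≈ (X + A) * (X + A * ω) * (X + A * ω * ω)
    F-factorisation X = ≈-lincomb₁ ω-root (- ((X + A) * (A * X + A * A * (ω - 1ℤ)))) (lemma X A ω)
      where lemma : ∀ X A ω → X * X * X + A * A * A - (X + A) * (X + A * ω) * (X + A * ω * ω)
                            ≡ - ((X + A) * (A * X + A * A * (ω - 1ℤ))) * (ω * ω + ω + 1ℤ - 0ℤ)
            lemma = solve-∀

    r₁ r₂ r₃ : Fin p
    r₁ = residue (- A)
    r₂ = residue (- (A * ω))
    r₃ = residue (- (A * ω * ω))

    linear-root : ∀ {x c} → ι x + c ≈ 0ℤ → x ≡ residue (- c)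
    linear-root {x} {c} x+c≈0 = ι≈⇒≡residue (≈-lincomb₁ x+c≈0 1ℤ (lemma (ι x) c))
      where lemma : ∀ X c → X - - c ≡ 1ℤ * (X + c - 0ℤ)
            lemma = solve-∀

    F≈0⇒root : ∀ x → F (ι x) ≈ 0ℤ → x ∈ r₁ ∷ r₂ ∷ r₃ ∷ []
    F≈0⇒root x Fx≈0 =
      [ [ here ∘ linear-root , there ∘ here ∘ linear-root ]′ ∘ *≈0⇒≈0⊎≈0 (ι x + A) (ι x + A * ω)
      , there ∘ there ∘ here ∘ linear-root
      ]′ (*≈0⇒≈0⊎≈0 ((ι x + A) * (ι x + A * ω)) (ι x + A * ω * ω) (≈-trans (≈-sym (F-factorisation (ι x))) Fx≈0))

    F-r₁≈0 : F (ι r₁) ≈ 0ℤ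
    F-r₁≈0 = ≈-trans (F-cong (ι-residue (- A))) (≈-reflexive (lemma A))
      where lemma : ∀ A → - A * - A * - A + A * A * A ≡ 0ℤ
            lemma = solve-∀

    F-r₂≈0 : F (ι r₂) ≈ 0ℤ
    F-r₂≈0 = ≈-trans (F-cong (ι-residue (- (A * ω)))) (≈-lincomb₁ ω³≈1 (- (A * A * A)) (lemma A ω))
      where lemma : ∀ A ω → - (A * ω) * - (A * ω) * - (A * ω) + A * A * A - 0ℤ ≡ - (A * A * A) * (ω * ω * ω - 1ℤ)
            lemma = solve-∀

    F-r₃≈0 : F (ι r₃) ≈ 0ℤ
    F-r₃≈0 = ≈-trans (F-cong (ι-residue (- (A * ω * ω)))) (≈-lincomb₁ ω³≈1 (- (A * A * A) * (ω * ω * ω + 1ℤ)) (lemma A ω))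
      where lemma : ∀ A ω → - (A * ω * ω) * - (A * ω * ω) * - (A * ω * ω) + A * A * A - 0ℤ
                            ≡ - (A * A * A) * (ω * ω * ω + 1ℤ) * (ω * ω * ω - 1ℤ)
            lemma = solve-∀

    r₁≢r₂ : ¬ r₁ ≡ r₂
    r₁≢r₂ eq = ≉0-* A≉0 ω-1≉0 (≈-lincomb₁ (residue≡⇒≈ eq) 1ℤ (lemma A ω))
      where lemma : ∀ A ω → A * (ω - 1ℤ) - 0ℤ ≡ 1ℤ * (- A - - (A * ω))
            lemma = solve-∀

    r₁≢r₃ : ¬ r₁ ≡ r₃
    r₁≢r₃ eq = ≉0-* A≉0 (≉0-* ω-1≉0 ω+1≉0) (≈-lincomb₁ (residue≡⇒≈ eq) 1ℤ (lemma A ω))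
      where lemma : ∀ A ω → A * ((ω - 1ℤ) * (ω + 1ℤ)) - 0ℤ ≡ 1ℤ * (- A - - (A * ω * ω))
            lemma = solve-∀

    r₂≢r₃ : ¬ r₂ ≡ r₃
    r₂≢r₃ eq = ≉0-* A≉0 (≉0-* ω≉0 ω-1≉0) (≈-lincomb₁ (residue≡⇒≈ eq) 1ℤ (lemma A ω))
      where lemma : ∀ A ω → A * (ω * (ω - 1ℤ)) - 0ℤ ≡ 1ℤ * (- (A * ω) - - (A * ω * ω))
            lemma = solve-∀

    #roots-of-F≡3 : ∑ (λ x → 𝟙 (F (ι x) ≈? 0ℤ)) ≡ 3
    #roots-of-F≡3 = ∑-𝟙≡length (λ x → F (ι x) ≈? 0ℤ) (r₁ ∷ r₂ ∷ r₃ ∷ [])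
      ((r₁≢r₂ ∷ r₁≢r₃ ∷ []) ∷ (r₂≢r₃ ∷ []) ∷ [] ∷ []) F≈0⇒root (F-r₁≈0 ∷ F-r₂≈0 ∷ F-r₃≈0 ∷ [])

    #affine≡3+4K : ∃ λ K → #affine ≡ 3 ℕ.+ 4 ℕ.* K
    #affine≡3+4K =
      let K , ∑h≡2K = ∑h-even in K , (begin
        ∑ (λ x → #√ (F (ι x)))                                ≡⟨ sum-cong-≗ (λ x → #√≡ 2≉0 (F (ι x))) ⟩
        ∑ (λ x → 𝟙 (F (ι x) ≈? 0ℤ) ℕ.+ 2 ℕ.* h x)             ≡⟨ ∑-distrib-+ (λ x → 𝟙 (F (ι x) ≈? 0ℤ)) _ ⟩
        ∑ (λ x → 𝟙 (F (ι x) ≈? 0ℤ)) ℕ.+ ∑ (λ x → 2 ℕ.* h x)   ≡⟨ cong₂ ℕ._+_ #roots-of-F≡3 (sym (*-distribˡ-sum 2 h)) ⟩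
        3 ℕ.+ 2 ℕ.* ∑ h                                        ≡⟨ cong (λ t → 3 ℕ.+ 2 ℕ.* t) ∑h≡2K ⟩
        3 ℕ.+ 2 ℕ.* (2 ℕ.* K)                                  ≡⟨ cong (3 ℕ.+_) (ℕ.*-assoc 2 2 K) ⟨
        3 ℕ.+ 4 ℕ.* K                                          ∎)
      where open ≡-Reasoning

module Mod12 where

  import Data.Nat as ℕ
  open import Data.Nat using (suc)
  open import Data.Nat.DivMod using (m∣n⇒o%n%m≡o%m)
  open import Data.Nat.Divisibility using (divides)
  open import Data.Nat.Primality using (¬prime[1])
  open import Data.Integer using (_+_; _*_; _-_; 0ℤ; 1ℤ)
  import Data.Integer.Properties as ℤ
  open import Data.Integer.Tactic.RingSolver using (solve-∀)
  open import Data.Empty using (⊥-elim)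
  open import Relation.Nullary using (Dec; yes; no)
  open import Relation.Binary.PropositionalEquality using (sym; trans; cong; cong₂)

  open Counting using (𝟙)
  open Congruence 12 public

  prime∧≡1or7[mod12]⇒3< : ∀ {p} → Prime p → p % 12 ≡ 1 ⊎ p % 12 ≡ 7 → 3 ℕ.< p
  prime∧≡1or7[mod12]⇒3< {0}     _       = [ (λ ()) , (λ ()) ]′
  prime∧≡1or7[mod12]⇒3< {1}     1-prime = λ _ → ⊥-elim (¬prime[1] 1-prime)
  prime∧≡1or7[mod12]⇒3< {2}     _       = [ (λ ()) , (λ ()) ]′
  prime∧≡1or7[mod12]⇒3< {3}     _       = [ (λ ()) , (λ ()) ]′
  prime∧≡1or7[mod12]⇒3< {suc (suc (suc (suc _)))} _ _ = ℕ.s≤s (ℕ.s≤s (ℕ.s≤s (ℕ.s≤s ℕ.z≤n)))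

  ≡1or7[mod12]⇒≡1[mod3] : ∀ p → p % 12 ≡ 1 ⊎ p % 12 ≡ 7 → p % 3 ≡ 1
  ≡1or7[mod12]⇒≡1[mod3] p p%12≡1∨7 =
    trans (sym (m∣n⇒o%n%m≡o%m 3 12 p (divides 4 refl))) ([ cong (_% 3) , cong (_% 3) ]′ p%12≡1∨7)

  ≈-CRT : ∀ n K k e → n ≡ 3 ℕ.+ 4 ℕ.* K → n ≡ 2 ℕ.* e ℕ.+ 3 ℕ.* k → + n ≈ + 3 + + 8 * + e
  ≈-CRT n K k e n≡3+4K n≡2e+3k =
    ≈-lincomb₃ (≈-reflexive n≡3+4Kℤ) (≈-reflexive n≡2e+3kℤ) modulus≈0 (- + 3) (+ 4) (+ k - + K - 1ℤ)
      (lemma (+ n) (+ K) (+ k) (+ e))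
    where
    n≡3+4Kℤ : + n ≡ + 3 + + 4 * + K
    n≡3+4Kℤ = trans (cong +_ n≡3+4K) (cong (λ t → + 3 + t) (ℤ.pos-* 4 K))
    n≡2e+3kℤ : + n ≡ + 2 * + e + + 3 * + k
    n≡2e+3kℤ = trans (cong +_ n≡2e+3k) (trans (ℤ.pos-+ (2 ℕ.* e) (3 ℕ.* k)) (cong₂ _+_ (ℤ.pos-* 2 e) (ℤ.pos-* 3 k)))
    lemma : ∀ n K k e → n - (+ 3 + + 8 * e) ≡ - + 3 * (n - (+ 3 + + 4 * K)) + + 4 * (n - (+ 2 * e + + 3 * k))
                                             + (k - K - 1ℤ) * (+ 12 - 0ℤ)
    lemma = solve-∀

  suc-%12≡0⊎4 : ∀ {P : Set} (P? : Dec P) n K k → n ≡ 3 ℕ.+ 4 ℕ.* K → n ≡ 2 ℕ.* 𝟙 P? ℕ.+ 3 ℕ.* k →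
                suc n % 12 ≡ 0 ⊎ suc n % 12 ≡ 4
  suc-%12≡0⊎4 P? n K k n≡3+4K n≡2e+3k with P?
  ... | yes _ = inj₁ (≈⇒%ℕ-≡ (≈-trans (+-cong (≈-refl {1ℤ}) (≈-CRT n K k 1 n≡3+4K n≡2e+3k))
                                      (≈-lincomb₁ {b = 0ℤ} modulus≈0 1ℤ refl)))
  ... | no _  = inj₂ (≈⇒%ℕ-≡ (+-cong (≈-refl {1ℤ}) (≈-CRT n K k 0 n≡3+4K n≡2e+3k)))

  trace≈ : ∀ p .{{_ : NonZero p}} a {r s} → p % 12 ≡ r % 12 → N p a % 12 ≡ s % 12 → trace p a ≈ + suc r - + s
  trace≈ p a {r} {s} p≡r N≡s = +-cong (+-cong (≈-refl {1ℤ}) (%-≡⇒≈ p r p≡r)) (-‿cong (%-≡⇒≈ (N p a) s N≡s))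

module PointCount (p : ℕ) .{{_ : NonZero p}} (prime : Prime p) (a : ℕ) where

  import Data.Nat as ℕ
  import Data.Nat.Properties as ℕ
  open import Data.Nat.DivMod using (m*n%n≡0)
  open import Data.Integer using (_+_; _*_; 0ℤ)
  import Data.Integer.Properties as ℤ
  open import Data.Fin using (toℕ)
  open import Data.List using (length; allFin)
  open import Data.Product using (_,_)
  open import Function using (id)
  open import Relation.Binary.PropositionalEquality using (sym; trans; cong; cong₂; subst₂)

  open Counting
  open PrimeField p prime
  open CubeRootOfUnity p prime
  open Squares p prime
  open Curve p prime
  open Mod12 using (prime∧≡1or7[mod12]⇒3<; ≡1or7[mod12]⇒≡1[mod3]; suc-%12≡0⊎4)

  ℕ→ℤ-cubes : ∀ m n → + (m ℕ.* m ℕ.* m ℕ.+ n ℕ.* n ℕ.* n) ≡ + m * + m * + m + + n * + n * + n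
  ℕ→ℤ-cubes m n = trans (ℤ.pos-+ (m ℕ.* m ℕ.* m) (n ℕ.* n ℕ.* n)) (cong₂ _+_ (cube m) (cube n))
    where
    cube : ∀ k → + (k ℕ.* k ℕ.* k) ≡ + k * + k * + k
    cube k = trans (ℤ.pos-* (k ℕ.* k) k) (cong (_* + k) (ℤ.pos-* k k))

  onCurve⇒≈ : ∀ x y → OnCurve p a (x , y) → ι y * ι y ≈ ι x * ι x * ι x + + a * + a * + a
  onCurve⇒≈ x y on = subst₂ _≈_ (ℤ.pos-* (toℕ y) (toℕ y)) (ℕ→ℤ-cubes (toℕ x) a) (%-≡⇒≈ _ _ on)

  ≈⇒onCurve : ∀ x y → ι y * ι y ≈ ι x * ι x * ι x + + a * + a * + a → OnCurve p a (x , y)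
  ≈⇒onCurve x y y²≈F =
    ≈⇒%ℕ-≡ (subst₂ _≈_ (sym (ℤ.pos-* (toℕ y) (toℕ y))) (sym (ℕ→ℤ-cubes (toℕ x) a)) y²≈F)

  length-affinePoints : length (affinePoints p a) ≡ ∑ (λ x → #√ (ι x * ι x * ι x + + a * + a * + a))
  length-affinePoints = trans (length-filter-cartesianProduct (onCurve? p a) id (allFin p))
    (sum-cong-≗ λ x → trans (length-filter-tabulate (λ y → onCurve? p a (x , y)) id)
      (sum-cong-≗ λ y → 𝟙-⇔ (onCurve? p a (x , y)) (ι y * ι y ≈? _) (onCurve⇒≈ x y) (≈⇒onCurve x y)))

  N%12≡0⊎4 : p % 12 ≡ 1 ⊎ p % 12 ≡ 7 → ¬ a % p ≡ 0 → N p a % 12 ≡ 0 ⊎ N p a % 12 ≡ 4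
  N%12≡0⊎4 p%12≡1∨7 a%p≢0 =
    let ω , ω-root          = cube-root-of-unity (≡1or7[mod12]⇒≡1[mod3] p p%12≡1∨7)
        K , #affine≡3+4K′   = #affine≡3+4K 2≉0 3≉0 ω ω-root (+ a) a≉0
        k , #affine≡2e+3k′  = #affine≡2e+3k 2≉0 3≉0 ω ω-root (+ a) a≉0
    in  suc-%12≡0⊎4 (isNonzeroSquare? (+ a * + a * + a)) (length (affinePoints p a)) K k
          (trans length-affinePoints #affine≡3+4K′) (trans length-affinePoints #affine≡2e+3k′)
    where
    3<p : 3 ℕ.< p
    3<p = prime∧≡1or7[mod12]⇒3< prime p%12≡1∨7
    2≉0 : + 2 ≉ 0ℤ
    2≉0 = small≉0 (ℕ.s≤s ℕ.z≤n) (ℕ.<-trans (ℕ.n<1+n 2) 3<p)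
    3≉0 : + 3 ≉ 0ℤ
    3≉0 = small≉0 (ℕ.s≤s ℕ.z≤n) 3<p
    a≉0 : + a ≉ 0ℤ
    a≉0 a≈0 = a%p≢0 (trans (≈⇒%ℕ-≡ a≈0) (m*n%n≡0 0 p))

corollary6 : (p : ℕ) → .{{_ : NonZero p}} → Prime p → (a : ℕ) → ¬ (a % p ≡ 0) →
    ((p % 12 ≡ 1 → (trace p a %ℕ 12 ≡ (+ 2) %ℕ 12) ⊎ (trace p a %ℕ 12 ≡ (- (+ 2)) %ℕ 12))
    × (p % 12 ≡ 7 → (trace p a %ℕ 12 ≡ (+ 4) %ℕ 12) ⊎ (trace p a %ℕ 12 ≡ (- (+ 4)) %ℕ 12)))
corollary6 p p-prime a a%p≢0 = p≡1[mod12] , p≡7[mod12]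
  where
  open Mod12
  open PointCount p p-prime a using (N%12≡0⊎4)
  p≡1[mod12] : p % 12 ≡ 1 → (trace p a %ℕ 12 ≡ (+ 2) %ℕ 12) ⊎ (trace p a %ℕ 12 ≡ (- (+ 2)) %ℕ 12)
  p≡1[mod12] p≡1 =
    [ (λ N≡0 → inj₁ (≈⇒%ℕ-≡ (trace≈ p a {1} {0} p≡1 N≡0)))
    , (λ N≡4 → inj₂ (≈⇒%ℕ-≡ (trace≈ p a {1} {4} p≡1 N≡4)))
    ]′ (N%12≡0⊎4 (inj₁ p≡1) a%p≢0)
  p≡7[mod12] : p % 12 ≡ 7 → (trace p a %ℕ 12 ≡ (+ 4) %ℕ 12) ⊎ (trace p a %ℕ 12 ≡ (- (+ 4)) %ℕ 12)
  p≡7[mod12] p≡7 =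
    [ (λ N≡0 → inj₂ (≈⇒%ℕ-≡ (≈-trans (trace≈ p a {7} {0} p≡7 N≡0) 8≈-4)))
    , (λ N≡4 → inj₁ (≈⇒%ℕ-≡ (trace≈ p a {7} {4} p≡7 N≡4)))
    ]′ (N%12≡0⊎4 (inj₂ p≡7) a%p≢0)
    where
    8≈-4 : + 8 ≈ - + 4
    8≈-4 = ≈-lincomb₁ modulus≈0 1ℤ refl
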